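{- Fix an integer $d\ge 1$ and consider the $d$-dimensional P-RAN process described in the context. For integers $k$ and $t\ge0$ let $N_t(k)$ be the number of vertices of $G_t$ of degree $k$. Then for every $k\ge d+1$ the limit $$P(k)=\lim_{t\to\infty}\frac{\mathbb{E}[N_t(k)]}{d+2+t}$$ exists, and $$P(d+1)=\frac12,\qquad P(k)=\frac{dk-d^2-d+1}{dk-d^2+d+2}\,P(k-1)\quad\text{for } k>d+1.$$
   Context: The $d$-dimensional P-RAN process: at time $t=0$ the graph $G_0$ is the complete graph on $d+2$ vertices, and $\mathcal{C}_0$ is the set of its $d+2$ vertex subsets of size $d+1$ (its $(d+1)$-cliques). For each $t\ge 1$, a clique $c$ is chosen uniformly at random from $\mathcal{C}_{t-1}$ (independently of the past given the current state); a new vertex $v$ is added and joined by edges to all $d+1$ vertices of $c$, giving $G_t$; and $\mathcal{C}_t=\mathcal{C}_{t-1}\cup\{(c\setminus\{x\})\cup\{v\}: x\in c\}$ (so $c$ remains in $\mathcal{C}_t$ and can be chosen again). Thus $|\mathcal{C}_t|=d+2+(d+1)t$ and $G_t$ has $d+2+t$ vertices. -}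

module Defs where

open import Data.Nat as ℕ using (ℕ; zero; suc; _≡ᵇ_)
open import Data.Bool using (Bool; not; _∨_)
open import Data.List using (List; []; _∷_; map; filterᵇ; length; _++_; upTo; concatMap; foldr)
open import Data.Product using (_×_; _,_; proj₁; proj₂)
open import Data.Integer as ℤ using (ℤ; +_)
open import Data.Rational using (ℚ; 0ℚ; _+_; _*_; _/_)

-- Vertices are natural numbers; G_t has vertex set {0, …, d+1+t},
-- the vertex added at step t being d+1+t.
-- A clique is a list of d+1 distinct vertices; an edge is an ordered pair.
record State : Set where
  constructor mkState
  field
    nv      : ℕ                 -- number of vertices (next fresh vertex name)
    cliques : List (List ℕ)     -- the family C_t (each clique listed once)
    edges   : List (ℕ × ℕ)      -- edge list of G_t (each edge listed once)
open State public

remove : ℕ → List ℕ → List ℕ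
remove x c = filterᵇ (λ y → not (y ≡ᵇ x)) c

-- initial state: complete graph K_{d+2} and its d+2 cliques of size d+1
initial : ℕ → State
initial d = mkState (suc (suc d))
  (map (λ x → remove x (upTo (suc (suc d)))) (upTo (suc (suc d))))
  (concatMap (λ i → map (λ j → (j , i)) (upTo i)) (upTo (suc (suc d))))

step : State → List ℕ → State
step s c = mkState (suc (nv s))
  (cliques s ++ map (λ x → nv s ∷ remove x c) c)
  (edges s ++ map (λ x → (x , nv s)) c)

sumℚ : List ℚ → ℚ
sumℚ = foldr _+_ 0ℚ

avg : List ℚ → ℚ
avg []       = 0ℚ
avg (q ∷ qs) = sumℚ (q ∷ qs) * ((+ 1) / suc (length qs))

-- expect t s f : expected value of f(state after t further steps from s),
-- each step choosing a clique uniformly at random from the current family.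
expect : ℕ → State → (State → ℚ) → ℚ
expect zero    s f = f s
expect (suc t) s f = avg (map (λ c → expect t (step s c) f) (cliques s))

degree : State → ℕ → ℕ
degree s u = length (filterᵇ (λ e → (proj₁ e ≡ᵇ u) ∨ (proj₂ e ≡ᵇ u)) (edges s))

N : ℕ → State → ℕ
N k s = length (filterᵇ (λ u → degree s u ≡ᵇ k) (upTo (nv s)))

EN : (d t k : ℕ) → ℚ
EN d t k = expect t (initial d) (λ s → (+ N k s) / 1)

normalizedEN : (d t k : ℕ) → ℚ
normalizedEN d t k = EN d t k * ((+ 1) / suc (suc (d ℕ.+ t)))

-- the ratio (dk - d^2 - d + 1) / (dk - d^2 + d + 2); for k ≥ d the
-- denominator equals suc (d k + d + 1 ∸ d^2) exactly.
ratio : (d k : ℕ) → ℚ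
ratio d k = (+ (d ℕ.* k) ℤ.- + (d ℕ.* d) ℤ.- + d ℤ.+ + 1)
            / suc (d ℕ.* k ℕ.+ d ℕ.+ 1 ℕ.∸ d ℕ.* d)

-- A vertex of degree g lies in exactly d g + 1 − d² of the cliques, so a step raises it to degree
-- g+1 with probability α(g)/|C_t|, where α(g) = d g + 1 − d² and |C_t| = d+2+(d+1)t.  Counting
-- vertices by degree turns this into the exact linear recurrence
--   E N_{t+1}(k) = E N_t(k) + (α(k−1) E N_t(k−1) − α(k) E N_t(k)) / |C_t| + [k = d+1].
-- Let P solve P(k) (α(k) + d + 1) = α(k−1) P(k−1) + (d+1) [k = d+1], i.e. P(d+1) = 1/2 and the
-- stated ratio recurrence.  By induction on k, E N_t(k) − P(k) (d+2+t) stays bounded: given the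
-- bound for k−1, the deviation for k obeys a recurrence that contracts once α(k) ≤ |C_t|.
-- Dividing by d+2+t gives the limit.

module Submission where

module Counting where

  open import Data.Bool.Base using (Bool; true; false; not; _∧_)
  open import Data.List.Base using (List; []; _∷_; map; filterᵇ; length; _++_; concat; upTo)
  open import Data.List.Properties using (applyUpTo-∷ʳ)
  open import Data.List.Relation.Unary.All using (All; []; _∷_)
  open import Data.Nat.Base
  open import Data.Nat.Properties
  open import Data.Empty using (⊥-elim)
  open import Relation.Nullary using (yes; no)
  open import Relation.Binary.PropositionalEquality
  open import Algebra.Properties.CommutativeSemigroup +-commutativeSemigroup using (interchange)

  private
    variable
      A B : Set
      x : A
      xs ys : List A
      p q : A → Bool
      f g : A → ℕ

  𝕀 : Bool → ℕ
  𝕀 true  = 1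
  𝕀 false = 0

  count : (A → Bool) → List A → ℕ
  count p xs = length (filterᵇ p xs)

  ∑ : List A → (A → ℕ) → ℕ
  ∑ []       f = 0
  ∑ (x ∷ xs) f = f x + ∑ xs f

  syntax ∑ xs (λ x → e) = ∑[ x ∈ xs ] e

  ∑< : ℕ → (ℕ → ℕ) → ℕ
  ∑< zero    f = 0
  ∑< (suc n) f = ∑< n f + f n

  syntax ∑< n (λ u → e) = ∑[ u < n ] e

  occ : ℕ → List ℕ → ℕ
  occ u = count (_≡ᵇ u)

  ≡ᵇ-refl : ∀ n → (n ≡ᵇ n) ≡ true
  ≡ᵇ-refl zero    = refl
  ≡ᵇ-refl (suc n) = ≡ᵇ-refl n

  ≡ᵇ-true⇒≡ : ∀ m n → (m ≡ᵇ n) ≡ true → m ≡ n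
  ≡ᵇ-true⇒≡ zero    zero    _ = refl
  ≡ᵇ-true⇒≡ (suc m) (suc n) e = cong suc (≡ᵇ-true⇒≡ m n e)

  ≢⇒≡ᵇ-false : ∀ m n → m ≢ n → (m ≡ᵇ n) ≡ false
  ≢⇒≡ᵇ-false m n m≢n with m ≡ᵇ n in e
  ... | true  = ⊥-elim (m≢n (≡ᵇ-true⇒≡ m n e))
  ... | false = refl

  ≡ᵇ-sym : ∀ m n → (m ≡ᵇ n) ≡ (n ≡ᵇ m)
  ≡ᵇ-sym zero    zero    = refl
  ≡ᵇ-sym zero    (suc n) = refl
  ≡ᵇ-sym (suc m) zero    = refl
  ≡ᵇ-sym (suc m) (suc n) = ≡ᵇ-sym m n

  count-∷ : ∀ (p : A → Bool) x xs → count p (x ∷ xs) ≡ 𝕀 (p x) + count p xs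
  count-∷ p x xs with p x
  ... | true  = refl
  ... | false = refl

  count≡∑𝕀 : ∀ (p : A → Bool) xs → count p xs ≡ ∑[ x ∈ xs ] 𝕀 (p x)
  count≡∑𝕀 p []       = refl
  count≡∑𝕀 p (x ∷ xs) = trans (count-∷ p x xs) (cong (𝕀 (p x) +_) (count≡∑𝕀 p xs))

  count-filter : ∀ (p q : A → Bool) xs → count p (filterᵇ q xs) ≡ count (λ x → q x ∧ p x) xs
  count-filter p q []       = refl
  count-filter p q (x ∷ xs) with q x
  ... | false = count-filter p q xs
  ... | true with p x
  ...   | true  = cong suc (count-filter p q xs)
  ...   | false = count-filter p q xs

  count+count-not : ∀ (p : A → Bool) xs → count p xs + count (λ x → not (p x)) xs ≡ length xs
  count+count-not p []       = refl
  count+count-not p (x ∷ xs) with p x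
  ... | true  = cong suc (count+count-not p xs)
  ... | false = trans (+-suc _ _) (cong suc (count+count-not p xs))

  count-mono : ∀ (p q : A → Bool) xs → (∀ x → p x ≡ true → q x ≡ true) → count p xs ≤ count q xs
  count-mono p q []       p⇒q = z≤n
  count-mono p q (x ∷ xs) p⇒q with p x in px | q x in qx
  ... | true  | true  = s≤s (count-mono p q xs p⇒q)
  ... | true  | false with () ← trans (sym (p⇒q x px)) qx
  ... | false | true  = m≤n⇒m≤1+n (count-mono p q xs p⇒q)
  ... | false | false = count-mono p q xs p⇒q

  count-all : ∀ (p : A → Bool) xs → All (λ x → p x ≡ true) xs → count p xs ≡ length xs
  count-all p []       []          = refl
  count-all p (x ∷ xs) (px ∷ pxs) = trans (count-∷ p x xs) (cong₂ _+_ (cong 𝕀 px) (count-all p xs pxs))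

  count-none : ∀ (p : A → Bool) xs → All (λ x → p x ≡ false) xs → count p xs ≡ 0
  count-none p []       []          = refl
  count-none p (x ∷ xs) (px ∷ pxs) = trans (count-∷ p x xs) (cong₂ _+_ (cong 𝕀 px) (count-none p xs pxs))

  ∑-cong : ∀ (xs : List A) → (∀ x → f x ≡ g x) → ∑ xs f ≡ ∑ xs g
  ∑-cong []       f≗g = refl
  ∑-cong (x ∷ xs) f≗g = cong₂ _+_ (f≗g x) (∑-cong xs f≗g)

  ∑-cong-All : {P : A → Set} → All P xs → (∀ x → P x → f x ≡ g x) → ∑ xs f ≡ ∑ xs g
  ∑-cong-All []         f≗g = refl
  ∑-cong-All (px ∷ pxs) f≗g = cong₂ _+_ (f≗g _ px) (∑-cong-All pxs f≗g)

  ∑-++ : ∀ (xs ys : List A) f → ∑ (xs ++ ys) f ≡ ∑ xs f + ∑ ys f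
  ∑-++ []       ys f = refl
  ∑-++ (x ∷ xs) ys f = trans (cong (f x +_) (∑-++ xs ys f)) (sym (+-assoc (f x) _ _))

  ∑-map : ∀ (h : A → B) xs (f : B → ℕ) → ∑ (map h xs) f ≡ ∑[ x ∈ xs ] f (h x)
  ∑-map h []       f = refl
  ∑-map h (x ∷ xs) f = cong (f (h x) +_) (∑-map h xs f)

  ∑-+ : ∀ (xs : List A) f g → ∑[ x ∈ xs ] (f x + g x) ≡ ∑ xs f + ∑ xs g
  ∑-+ []       f g = refl
  ∑-+ (x ∷ xs) f g = trans (cong (f x + g x +_) (∑-+ xs f g)) (interchange (f x) (g x) _ _)

  ∑-*ʳ : ∀ (xs : List A) f c → ∑[ x ∈ xs ] (f x * c) ≡ ∑ xs f * c
  ∑-*ʳ []       f c = refl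
  ∑-*ʳ (x ∷ xs) f c = trans (cong (f x * c +_) (∑-*ʳ xs f c)) (sym (*-distribʳ-+ c (f x) (∑ xs f)))

  ∑-const : ∀ (xs : List A) c → ∑[ _ ∈ xs ] c ≡ length xs * c
  ∑-const []       c = refl
  ∑-const (x ∷ xs) c = cong (c +_) (∑-const xs c)

  ∑-zero : ∀ (xs : List A) f → All (λ x → f x ≡ 0) xs → ∑ xs f ≡ 0
  ∑-zero []       f []          = refl
  ∑-zero (x ∷ xs) f (fx≡0 ∷ fxs≡0) rewrite fx≡0 = ∑-zero xs f fxs≡0

  count-++ : ∀ (p : A → Bool) xs ys → count p (xs ++ ys) ≡ count p xs + count p ys
  count-++ p xs ys = begin
    count p (xs ++ ys)                                    ≡⟨ count≡∑𝕀 p (xs ++ ys) ⟩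
    ∑[ x ∈ xs ++ ys ] 𝕀 (p x)                             ≡⟨ ∑-++ xs ys _ ⟩
    ∑[ x ∈ xs ] 𝕀 (p x) + ∑[ x ∈ ys ] 𝕀 (p x)             ≡⟨ sym (cong₂ _+_ (count≡∑𝕀 p xs) (count≡∑𝕀 p ys)) ⟩
    count p xs + count p ys                               ∎
    where open ≡-Reasoning

  count-map : ∀ (p : B → Bool) (h : A → B) xs → count p (map h xs) ≡ count (λ x → p (h x)) xs
  count-map p h xs = trans (count≡∑𝕀 p (map h xs)) (trans (∑-map h xs _) (sym (count≡∑𝕀 _ xs)))

  count-concat : ∀ (p : A → Bool) xss → count p (concat xss) ≡ ∑[ xs ∈ xss ] count p xs
  count-concat p []         = refl
  count-concat p (xs ∷ xss) = trans (count-++ p xs (concat xss)) (cong (count p xs +_) (count-concat p xss))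

  count-cong : ∀ (xs : List A) → (∀ x → p x ≡ q x) → count p xs ≡ count q xs
  count-cong {p = p} {q = q} xs p≗q =
    trans (count≡∑𝕀 p xs) (trans (∑-cong xs (λ x → cong 𝕀 (p≗q x))) (sym (count≡∑𝕀 q xs)))

  ∑<-cong : ∀ n {f g : ℕ → ℕ} → (∀ u → u < n → f u ≡ g u) → ∑< n f ≡ ∑< n g
  ∑<-cong zero    f≗g = refl
  ∑<-cong (suc n) f≗g = cong₂ _+_ (∑<-cong n (λ u u<n → f≗g u (m<n⇒m<1+n u<n))) (f≗g n ≤-refl)

  ∑<-+ : ∀ n (f g : ℕ → ℕ) → ∑[ u < n ] (f u + g u) ≡ ∑< n f + ∑< n g
  ∑<-+ zero    f g = refl
  ∑<-+ (suc n) f g = trans (cong (_+ (f n + g n)) (∑<-+ n f g)) (interchange (∑< n f) (∑< n g) _ _)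

  ∑<-*ˡ : ∀ n c (f : ℕ → ℕ) → ∑[ u < n ] (c * f u) ≡ c * ∑< n f
  ∑<-*ˡ zero    c f = sym (*-zeroʳ c)
  ∑<-*ˡ (suc n) c f = trans (cong (_+ c * f n) (∑<-*ˡ n c f)) (sym (*-distribˡ-+ c (∑< n f) (f n)))

  ∑<-zero : ∀ n (f : ℕ → ℕ) → (∀ u → u < n → f u ≡ 0) → ∑< n f ≡ 0
  ∑<-zero zero    f f≡0 = refl
  ∑<-zero (suc n) f f≡0 =
    cong₂ _+_ (∑<-zero n f (λ u u<n → f≡0 u (m<n⇒m<1+n u<n))) (f≡0 n ≤-refl)

  ∑-∑<-comm : ∀ (xs : List A) n (h : A → ℕ → ℕ) → ∑[ x ∈ xs ] ∑< n (h x) ≡ ∑[ u < n ] ∑[ x ∈ xs ] h x u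
  ∑-∑<-comm []       n h = sym (∑<-zero n _ (λ _ _ → refl))
  ∑-∑<-comm (x ∷ xs) n h =
    trans (cong (∑< n (h x) +_) (∑-∑<-comm xs n h)) (sym (∑<-+ n (h x) (λ u → ∑[ x ∈ xs ] h x u)))

  ∑-upTo : ∀ n f → ∑ (upTo n) f ≡ ∑< n f
  ∑-upTo zero    f = refl
  ∑-upTo (suc n) f = begin
    ∑ (upTo (suc n)) f        ≡⟨ cong (λ l → ∑ l f) (sym (applyUpTo-∷ʳ (λ x → x) n)) ⟩
    ∑ (upTo n ++ n ∷ []) f    ≡⟨ ∑-++ (upTo n) _ f ⟩
    ∑ (upTo n) f + (f n + 0)  ≡⟨ cong₂ _+_ (∑-upTo n f) (+-identityʳ (f n)) ⟩
    ∑< n f + f n              ∎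
    where open ≡-Reasoning

  ∑<-select : ∀ n x (g : ℕ → ℕ) → x < n → ∑[ u < n ] (𝕀 (x ≡ᵇ u) * g u) ≡ g x
  ∑<-select (suc n) x g x<1+n with x ≟ n
  ... | yes refl = begin
    ∑[ u < x ] (𝕀 (x ≡ᵇ u) * g u) + 𝕀 (x ≡ᵇ x) * g x ≡⟨ cong₂ _+_ others (cong (λ b → 𝕀 b * g x) (≡ᵇ-refl x)) ⟩
    0 + 1 * g x                                        ≡⟨ *-identityˡ (g x) ⟩
    g x                                                ∎
    where
    open ≡-Reasoning
    others : ∑[ u < x ] (𝕀 (x ≡ᵇ u) * g u) ≡ 0
    others = ∑<-zero x _ (λ u u<x → cong (λ b → 𝕀 b * g u) (≢⇒≡ᵇ-false x u (>⇒≢ u<x)))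
  ... | no x≢n = begin
    ∑[ u < n ] (𝕀 (x ≡ᵇ u) * g u) + 𝕀 (x ≡ᵇ n) * g n ≡⟨ cong₂ _+_ (∑<-select n x g x<n)
                                                                    (cong (λ b → 𝕀 b * g n) (≢⇒≡ᵇ-false x n x≢n)) ⟩
    g x + 0                                            ≡⟨ +-identityʳ (g x) ⟩
    g x                                                ∎
    where
    open ≡-Reasoning
    x<n = ≤∧≢⇒< (s≤s⁻¹ x<1+n) x≢n

  occ-upTo : ∀ n u → occ u (upTo n) ≡ ∑[ v < n ] (𝕀 (u ≡ᵇ v) * 1)
  occ-upTo n u = begin
    occ u (upTo n)                   ≡⟨ count≡∑𝕀 _ (upTo n) ⟩
    ∑[ v ∈ upTo n ] 𝕀 (v ≡ᵇ u)      ≡⟨ ∑-upTo n _ ⟩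
    ∑[ v < n ] 𝕀 (v ≡ᵇ u)           ≡⟨ ∑<-cong n (λ v _ → trans (cong 𝕀 (≡ᵇ-sym v u)) (sym (*-identityʳ _))) ⟩
    ∑[ v < n ] (𝕀 (u ≡ᵇ v) * 1)     ∎
    where open ≡-Reasoning

  occ-upTo-< : ∀ {n u} → u < n → occ u (upTo n) ≡ 1
  occ-upTo-< {n} {u} u<n = trans (occ-upTo n u) (∑<-select n u (λ _ → 1) u<n)

  occ-upTo-≥ : ∀ {n u} → n ≤ u → occ u (upTo n) ≡ 0
  occ-upTo-≥ {n} {u} n≤u = trans (occ-upTo n u) (∑<-zero n _ (λ v v<n →
    cong (λ b → 𝕀 b * 1) (≢⇒≡ᵇ-false u v (>⇒≢ (<-≤-trans v<n n≤u)))))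

  occ-upTo≤1 : ∀ n u → occ u (upTo n) ≤ 1
  occ-upTo≤1 n u with u <? n
  ... | yes u<n = ≤-reflexive (occ-upTo-< u<n)
  ... | no  u≮n = subst (_≤ 1) (sym (occ-upTo-≥ (≮⇒≥ u≮n))) z≤n

  count-by-vertex : ∀ n c (p : ℕ → Bool) → All (_< n) c → count p c ≡ ∑[ u < n ] (occ u c * 𝕀 (p u))
  count-by-vertex n []      p []            = sym (∑<-zero n _ (λ _ _ → refl))
  count-by-vertex n (x ∷ c) p (x<n ∷ c<n) = begin
    count p (x ∷ c)
      ≡⟨ count-∷ p x c ⟩
    𝕀 (p x) + count p c
      ≡⟨ cong₂ _+_ (sym (∑<-select n x (λ u → 𝕀 (p u)) x<n)) (count-by-vertex n c p c<n) ⟩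
    ∑[ u < n ] (𝕀 (x ≡ᵇ u) * 𝕀 (p u)) + ∑[ u < n ] (occ u c * 𝕀 (p u))
      ≡⟨ sym (∑<-+ n _ _) ⟩
    ∑[ u < n ] (𝕀 (x ≡ᵇ u) * 𝕀 (p u) + occ u c * 𝕀 (p u))
      ≡⟨ ∑<-cong n (λ u _ → trans (sym (*-distribʳ-+ (𝕀 (p u)) (𝕀 (x ≡ᵇ u)) (occ u c)))
                                   (cong (_* 𝕀 (p u)) (sym (count-∷ (_≡ᵇ u) x c)))) ⟩
    ∑[ u < n ] (occ u (x ∷ c) * 𝕀 (p u))
      ∎
    where open ≡-Reasoning

module CliqueInvariant where

  open import Defs
  open Counting
  open import Data.Bool.Base using (Bool; true; false; not; _∧_; _∨_)
  open import Data.Bool.Properties using (∨-identityʳ; ∨-zeroʳ; ∧-zeroʳ)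
  open import Data.List.Base using (List; []; _∷_; map; length; upTo)
  open import Data.List.Properties using (length-++; length-map; length-upTo)
  open import Data.List.Relation.Unary.All as All using (All; []; _∷_)
  open import Data.List.Relation.Unary.All.Properties using (++⁺; map⁺; filter⁺; concat⁺; applyUpTo⁺₁; applyUpTo⁺₂)
  open import Data.Nat.Base
  open import Data.Nat.Properties
  open import Data.Nat.Solver using (module +-*-Solver)
  open import Data.Product using (_×_; _,_; proj₁; proj₂)
  open import Data.Sum using (inj₁; inj₂)
  open import Relation.Binary.PropositionalEquality
  open import Relation.Nullary using (yes; no)
  open import Relation.Nullary.Decidable using (T?)
  open +-*-Solver

  IsClique : ℕ → ℕ → List ℕ → Set
  IsClique d n c = All (_< n) c × (∀ u → occ u c ≤ 1) × length c ≡ suc d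

  memberships : State → ℕ → ℕ
  memberships s u = ∑[ c ∈ cliques s ] occ u c

  EdgeBelow : ℕ → ℕ × ℕ → Set
  EdgeBelow n e = proj₁ e < n × proj₂ e < n

  #cliques : ℕ → ℕ → ℕ
  #cliques d t = suc (suc (d + t * suc d))

  record Invariant (d t : ℕ) (s : State) : Set where
    field
      length-cliques : length (cliques s) ≡ #cliques d t
      cliques-wf     : All (IsClique d (nv s)) (cliques s)
      edges-wf       : All (EdgeBelow (nv s)) (edges s)
      -- A vertex starts with degree d+1 in d+1 cliques, and each choice of a clique through it
      -- adds one edge and d cliques.
      memberships≡   : ∀ u → u < nv s → memberships s u + d * d ≡ d * degree s u + 1
      degree≥        : ∀ u → u < nv s → suc d ≤ degree s u
  open Invariant public

  N≡∑< : ∀ k s → N k s ≡ ∑[ u < nv s ] 𝕀 (degree s u ≡ᵇ k)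
  N≡∑< k s = trans (count≡∑𝕀 _ (upTo (nv s))) (∑-upTo (nv s) _)

  degree-step : ∀ s c u → degree (step s c) u ≡ degree s u + count (λ x → (x ≡ᵇ u) ∨ (nv s ≡ᵇ u)) c
  degree-step s c u =
    trans (count-++ _ (edges s) (map (λ x → (x , nv s)) c)) (cong (degree s u +_) (count-map _ _ c))

  degree-step-old : ∀ s c {u} → u < nv s → degree (step s c) u ≡ degree s u + occ u c
  degree-step-old s c {u} u<n = trans (degree-step s c u) (cong (degree s u +_) (count-cong c (λ x →
    trans (cong ((x ≡ᵇ u) ∨_) (≢⇒≡ᵇ-false (nv s) u (>⇒≢ u<n))) (∨-identityʳ _))))

  degree-fresh : ∀ s {u} → All (EdgeBelow (nv s)) (edges s) → nv s ≤ u → degree s u ≡ 0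
  degree-fresh s {u} below n≤u = count-none _ (edges s) (All.map untouched below)
    where
    untouched : ∀ {e} → EdgeBelow (nv s) e → ((proj₁ e ≡ᵇ u) ∨ (proj₂ e ≡ᵇ u)) ≡ false
    untouched (a<n , b<n) =
      cong₂ _∨_ (≢⇒≡ᵇ-false _ _ (<⇒≢ (<-≤-trans a<n n≤u))) (≢⇒≡ᵇ-false _ _ (<⇒≢ (<-≤-trans b<n n≤u)))

  degree-step-new : ∀ s c → degree s (nv s) ≡ 0 → degree (step s c) (nv s) ≡ length c
  degree-step-new s c deg≡0 =
    trans (degree-step s c (nv s)) (cong₂ _+_ deg≡0 (count-all _ c (All.universal joined c)))
    where
    joined : ∀ x → ((x ≡ᵇ nv s) ∨ (nv s ≡ᵇ nv s)) ≡ true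
    joined x = trans (cong ((x ≡ᵇ nv s) ∨_) (≡ᵇ-refl (nv s))) (∨-zeroʳ _)

  remove-All : ∀ {P : ℕ → Set} x c → All P c → All P (remove x c)
  remove-All x c = filter⁺ (λ y → T? (not (y ≡ᵇ x)))

  occ-remove≤ : ∀ u x c → occ u (remove x c) ≤ occ u c
  occ-remove≤ u x c rewrite count-filter (_≡ᵇ u) (λ y → not (y ≡ᵇ x)) c =
    count-mono _ _ c (λ y → ∧-true⇒ʳ (not (y ≡ᵇ x)))
    where
    ∧-true⇒ʳ : ∀ a {b} → (a ∧ b) ≡ true → b ≡ true
    ∧-true⇒ʳ true e = e

  occ-remove : ∀ u x c → occ u (remove x c) + 𝕀 (x ≡ᵇ u) * occ u c ≡ occ u c
  occ-remove u x c rewrite count-filter (_≡ᵇ u) (λ y → not (y ≡ᵇ x)) c with x ≟ u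
  ... | yes refl rewrite ≡ᵇ-refl x =
    trans (cong (_+ (occ x c + 0)) (trans (count-cong c (λ y → not-∧-self (y ≡ᵇ x))) (count-none _ c (All.universal (λ _ → refl) c))))
          (+-identityʳ _)
    where
    not-∧-self : ∀ b → (not b ∧ b) ≡ false
    not-∧-self true  = refl
    not-∧-self false = refl
  ... | no x≢u rewrite ≢⇒≡ᵇ-false x u x≢u = trans (+-identityʳ _) (count-cong c ≢x-redundant)
    where
    ≢x-redundant : ∀ y → (not (y ≡ᵇ x) ∧ (y ≡ᵇ u)) ≡ (y ≡ᵇ u)
    ≢x-redundant y with y ≡ᵇ u in y≡u
    ... | false = ∧-zeroʳ _
    ... | true rewrite ≢⇒≡ᵇ-false y x (λ y≡x → x≢u (trans (sym y≡x) (≡ᵇ-true⇒≡ y u y≡u))) = refl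

  length-remove : ∀ x c → length (remove x c) + occ x c ≡ length c
  length-remove x c = trans (+-comm _ (occ x c)) (count+count-not (_≡ᵇ x) c)

  occ-≥ : ∀ {n u} c → All (_< n) c → n ≤ u → occ u c ≡ 0
  occ-≥ c c<n n≤u = count-none _ c (All.map (λ y<n → ≢⇒≡ᵇ-false _ _ (<⇒≢ (<-≤-trans y<n n≤u))) c<n)

  occ-∈ : ∀ c → All (λ x → 1 ≤ occ x c) c
  occ-∈ []      = []
  occ-∈ (y ∷ c) = here ∷ All.map there (occ-∈ c)
    where
    here : 1 ≤ occ y (y ∷ c)
    here rewrite count-∷ (_≡ᵇ y) y c | ≡ᵇ-refl y = s≤s z≤n
    there : ∀ {x} → 1 ≤ occ x c → 1 ≤ occ x (y ∷ c)
    there {x} 1≤occ rewrite count-∷ (_≡ᵇ x) y c = ≤-trans 1≤occ (m≤n+m _ _)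

  newClique-wf : ∀ d n c → IsClique d n c → All (λ x → IsClique d (suc n) (n ∷ remove x c)) c
  newClique-wf d n c (c<n , simple , |c|≡) = All.map (λ {x} → wf x) (occ-∈ c)
    where
    wf : ∀ x → 1 ≤ occ x c → IsClique d (suc n) (n ∷ remove x c)
    wf x x∈c = (n<1+n n ∷ All.map m<n⇒m<1+n (remove-All x c c<n)) , simple′ , cong suc |rest|
      where
      |rest| : length (remove x c) ≡ d
      |rest| = +-cancelʳ-≡ 1 _ _ (begin
        length (remove x c) + 1      ≡⟨ cong (length (remove x c) +_) (≤-antisym x∈c (simple x)) ⟩
        length (remove x c) + occ x c ≡⟨ length-remove x c ⟩
        length c                      ≡⟨ trans |c|≡ (+-comm 1 d) ⟩
        d + 1                         ∎)
        where open ≡-Reasoning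
      simple′ : ∀ u → occ u (n ∷ remove x c) ≤ 1
      simple′ u rewrite count-∷ (_≡ᵇ u) n (remove x c) with n ≡ᵇ u in n≡u
      ... | true rewrite occ-≥ (remove x c) (remove-All x c c<n) (≤-reflexive (≡ᵇ-true⇒≡ n u n≡u)) = s≤s z≤n
      ... | false = ≤-trans (occ-remove≤ u x c) (simple u)

  memberships-step : ∀ s c u → memberships (step s c) u ≡ memberships s u + ∑[ x ∈ c ] occ u (nv s ∷ remove x c)
  memberships-step s c u = trans (∑-++ (cliques s) _ (occ u)) (cong (memberships s u +_) (∑-map _ c (occ u)))

  -- An old vertex u ∈ c lies in every new clique except the one omitting u.
  ∑-occ-newCliques : ∀ d n c u → IsClique d n c → u < n → ∑[ x ∈ c ] occ u (n ∷ remove x c) ≡ d * occ u c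
  ∑-occ-newCliques d n c u (_ , simple , |c|≡) u<n = +-cancelʳ-≡ o _ _ (begin
    ∑[ x ∈ c ] occ u (n ∷ remove x c) + o
      ≡⟨ cong₂ _+_ (∑-cong c u∉fresh) (sym o*o≡o) ⟩
    ∑[ x ∈ c ] occ u (remove x c) + o * o
      ≡⟨ cong (λ m → ∑[ x ∈ c ] occ u (remove x c) + m * o) (count≡∑𝕀 (_≡ᵇ u) c) ⟩
    ∑[ x ∈ c ] occ u (remove x c) + ∑[ x ∈ c ] 𝕀 (x ≡ᵇ u) * o
      ≡⟨ cong (∑[ x ∈ c ] occ u (remove x c) +_) (sym (∑-*ʳ c _ o)) ⟩
    ∑[ x ∈ c ] occ u (remove x c) + ∑[ x ∈ c ] (𝕀 (x ≡ᵇ u) * o)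
      ≡⟨ sym (∑-+ c _ _) ⟩
    ∑[ x ∈ c ] (occ u (remove x c) + 𝕀 (x ≡ᵇ u) * o)
      ≡⟨ ∑-cong c (λ x → occ-remove u x c) ⟩
    ∑[ _ ∈ c ] o
      ≡⟨ trans (∑-const c o) (cong (_* o) |c|≡) ⟩
    o + d * o
      ≡⟨ +-comm o (d * o) ⟩
    d * o + o ∎)
    where
    open ≡-Reasoning
    o = occ u c
    u∉fresh : ∀ x → occ u (n ∷ remove x c) ≡ occ u (remove x c)
    u∉fresh x = trans (count-∷ (_≡ᵇ u) n (remove x c)) (cong (λ b → 𝕀 b + occ u (remove x c)) (≢⇒≡ᵇ-false n u (>⇒≢ u<n)))
    o*o≡o : o * o ≡ o
    o*o≡o with o | simple u
    ... | zero  | _       = refl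
    ... | suc zero | _    = refl
    ... | suc (suc _) | s≤s ()

  ∑-occ-newCliques-fresh : ∀ d n c → IsClique d n c → ∑[ x ∈ c ] occ n (n ∷ remove x c) ≡ suc d
  ∑-occ-newCliques-fresh d n c (c<n , _ , |c|≡) =
    trans (∑-cong c fresh∈new) (trans (∑-const c 1) (trans (*-identityʳ _) |c|≡))
    where
    fresh∈new : ∀ x → occ n (n ∷ remove x c) ≡ 1
    fresh∈new x = trans (count-∷ (_≡ᵇ n) n (remove x c))
      (cong₂ _+_ (cong 𝕀 (≡ᵇ-refl n)) (occ-≥ (remove x c) (remove-All x c c<n) ≤-refl))

  module _ {d t s} (I : Invariant d t s) (c : List ℕ) (c-wf : IsClique d (nv s) c) where

    private
      n = nv s
      s′ = step s c

    degree-new : degree s′ n ≡ suc d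
    degree-new = trans (degree-step-new s c (degree-fresh s (edges-wf I) ≤-refl)) (proj₂ (proj₂ c-wf))

    memberships≡-step : ∀ u → u < suc n → memberships s′ u + d * d ≡ d * degree s′ u + 1
    memberships≡-step u u<1+n with m<1+n⇒m<n∨m≡n u<1+n
    ... | inj₁ u<n = begin
      memberships s′ u + d * d
        ≡⟨ cong (_+ d * d) (trans (memberships-step s c u) (cong (memberships s u +_) (∑-occ-newCliques d n c u c-wf u<n))) ⟩
      memberships s u + d * occ u c + d * d
        ≡⟨ solve 3 (λ m o q → m :+ o :+ q := (m :+ q) :+ o) refl (memberships s u) (d * occ u c) (d * d) ⟩
      (memberships s u + d * d) + d * occ u c
        ≡⟨ cong (_+ d * occ u c) (memberships≡ I u u<n) ⟩
      d * degree s u + 1 + d * occ u c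
        ≡⟨ solve 3 (λ d g o → d :* g :+ con 1 :+ d :* o := d :* (g :+ o) :+ con 1) refl d (degree s u) (occ u c) ⟩
      d * (degree s u + occ u c) + 1
        ≡⟨ cong (λ g → d * g + 1) (sym (degree-step-old s c u<n)) ⟩
      d * degree s′ u + 1 ∎
      where open ≡-Reasoning
    ... | inj₂ refl = begin
      memberships s′ n + d * d
        ≡⟨ cong (_+ d * d) (trans (memberships-step s c n) (cong₂ _+_ outside (∑-occ-newCliques-fresh d n c c-wf))) ⟩
      0 + suc d + d * d
        ≡⟨ solve 1 (λ d → con 0 :+ (con 1 :+ d) :+ d :* d := d :* (con 1 :+ d) :+ con 1) refl d ⟩
      d * suc d + 1
        ≡⟨ cong (λ g → d * g + 1) (sym degree-new) ⟩
      d * degree s′ n + 1 ∎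
      where
      open ≡-Reasoning
      outside : memberships s n ≡ 0
      outside = ∑-zero (cliques s) (occ n) (All.map (λ c′-wf → occ-≥ _ (proj₁ c′-wf) ≤-refl) (cliques-wf I))

    degree≥-step : ∀ u → u < suc n → suc d ≤ degree s′ u
    degree≥-step u u<1+n with m<1+n⇒m<n∨m≡n u<1+n
    ... | inj₁ u<n  = subst (suc d ≤_) (sym (degree-step-old s c u<n)) (≤-trans (degree≥ I u u<n) (m≤m+n _ _))
    ... | inj₂ refl = ≤-reflexive (sym degree-new)

    step-preserves : Invariant d (suc t) s′
    step-preserves = record
      { length-cliques = trans (length-++ (cliques s)) (trans (cong₂ _+_ (length-cliques I) (trans (length-map _ c) (proj₂ (proj₂ c-wf))))
                         (solve 2 (λ d t → con 2 :+ (d :+ t :* (con 1 :+ d)) :+ (con 1 :+ d)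
                                         := con 2 :+ (d :+ (con 1 :+ t) :* (con 1 :+ d))) refl d t))
      ; cliques-wf     = ++⁺ (All.map (λ (c′<n , simple , |c′|) → All.map m<n⇒m<1+n c′<n , simple , |c′|) (cliques-wf I))
                           (map⁺ (newClique-wf d n c c-wf))
      ; edges-wf       = ++⁺ (All.map (λ (a<n , b<n) → m<n⇒m<1+n a<n , m<n⇒m<1+n b<n) (edges-wf I))
                           (map⁺ (All.map (λ x<n → m<n⇒m<1+n x<n , n<1+n n) (proj₁ c-wf)))
      ; memberships≡   = memberships≡-step
      ; degree≥        = degree≥-step
      }

  module _ (d : ℕ) where

    private
      n = suc (suc d)
      V = upTo n

    initialClique-wf : ∀ {x} → x < n → IsClique d n (remove x V)
    initialClique-wf {x} x<n =
      remove-All x V (applyUpTo⁺₁ (λ i → i) n (λ i<n → i<n)) , (λ u → ≤-trans (occ-remove≤ u x V) (occ-upTo≤1 n u)) , |clique|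
      where
      |clique| : length (remove x V) ≡ suc d
      |clique| = +-cancelʳ-≡ 1 _ _ (trans (cong (length (remove x V) +_) (sym (occ-upTo-< x<n)))
                 (trans (length-remove x V) (trans (length-upTo n) (+-comm 1 (suc d)))))

    memberships-initial : ∀ {u} → u < n → memberships (initial d) u ≡ suc d
    memberships-initial {u} u<n = +-cancelʳ-≡ 1 _ _ (begin
      memberships (initial d) u + 1
        ≡⟨ cong₂ _+_ (∑-map (λ x → remove x V) V (occ u)) (sym omitted-once) ⟩
      ∑[ x ∈ V ] occ u (remove x V) + ∑[ x ∈ V ] (𝕀 (x ≡ᵇ u) * occ u V)
        ≡⟨ sym (∑-+ V (λ x → occ u (remove x V)) (λ x → 𝕀 (x ≡ᵇ u) * occ u V)) ⟩
      ∑[ x ∈ V ] (occ u (remove x V) + 𝕀 (x ≡ᵇ u) * occ u V)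
        ≡⟨ ∑-cong V (λ x → occ-remove u x V) ⟩
      ∑[ _ ∈ V ] occ u V
        ≡⟨ ∑-const V (occ u V) ⟩
      length V * occ u V
        ≡⟨ cong₂ _*_ (length-upTo n) (occ-upTo-< u<n) ⟩
      n * 1
        ≡⟨ trans (*-identityʳ n) (+-comm 1 (suc d)) ⟩
      suc d + 1 ∎)
      where
      open ≡-Reasoning
      omitted-once : ∑[ x ∈ V ] (𝕀 (x ≡ᵇ u) * occ u V) ≡ 1
      omitted-once = begin
        ∑[ x ∈ V ] (𝕀 (x ≡ᵇ u) * occ u V) ≡⟨ ∑-*ʳ V (λ x → 𝕀 (x ≡ᵇ u)) (occ u V) ⟩
        ∑[ x ∈ V ] 𝕀 (x ≡ᵇ u) * occ u V   ≡⟨ cong (_* occ u V) (sym (count≡∑𝕀 (_≡ᵇ u) V)) ⟩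
        occ u V * occ u V                   ≡⟨ cong (λ o → o * o) (occ-upTo-< u<n) ⟩
        1                                   ∎

    -- The number of edges (j , i), j < i, of the initial complete graph that contain u.
    edgesAt : ℕ → ℕ → ℕ
    edgesAt u i = count (λ j → (j ≡ᵇ u) ∨ (i ≡ᵇ u)) (upTo i)

    edgesAt-< : ∀ {u i} → i < u → edgesAt u i ≡ 0
    edgesAt-< {u} {i} i<u = trans (count-cong (upTo i) (λ j → trans (cong ((j ≡ᵇ u) ∨_) (≢⇒≡ᵇ-false i u (<⇒≢ i<u)))
                                                                    (∨-identityʳ _)))
                                 (occ-upTo-≥ (<⇒≤ i<u))

    edgesAt-> : ∀ {u i} → u < i → edgesAt u i ≡ 1
    edgesAt-> {u} {i} u<i = trans (count-cong (upTo i) (λ j → trans (cong ((j ≡ᵇ u) ∨_) (≢⇒≡ᵇ-false i u (>⇒≢ u<i)))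
                                                                    (∨-identityʳ _)))
                                 (occ-upTo-< u<i)

    edgesAt-≡ : ∀ u → edgesAt u u ≡ u
    edgesAt-≡ u = trans (count-all _ (upTo u) (applyUpTo⁺₂ (λ j → j) u (λ j →
                    trans (cong ((j ≡ᵇ u) ∨_) (≡ᵇ-refl u)) (∨-zeroʳ _))))
                        (length-upTo u)

    ∑<-edgesAt : ∀ {u m} → u < m → suc (∑< m (edgesAt u)) ≡ m
    ∑<-edgesAt {u} {suc m} (s≤s u≤m) with m≤n⇒m<n∨m≡n u≤m
    ... | inj₁ u<m  = trans (cong (λ e → suc (∑< m (edgesAt u) + e)) (edgesAt-> u<m))
                            (trans (cong suc (+-comm _ 1)) (cong suc (∑<-edgesAt u<m)))
    ... | inj₂ refl = cong suc (cong₂ _+_ (∑<-zero u (edgesAt u) (λ i i<u → edgesAt-< i<u)) (edgesAt-≡ u))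

    degree-initial : ∀ {u} → u < n → degree (initial d) u ≡ suc d
    degree-initial {u} u<n = suc-injective (trans (cong suc (begin
      degree (initial d) u
        ≡⟨ count-concat touches (map (λ i → map (λ j → (j , i)) (upTo i)) V) ⟩
      ∑[ es ∈ map (λ i → map (λ j → (j , i)) (upTo i)) V ] count touches es
        ≡⟨ ∑-map (λ i → map (λ j → (j , i)) (upTo i)) V (count touches) ⟩
      ∑[ i ∈ V ] count touches (map (λ j → (j , i)) (upTo i))
        ≡⟨ ∑-cong V (λ i → count-map touches (λ j → (j , i)) (upTo i)) ⟩
      ∑ V (edgesAt u)
        ≡⟨ ∑-upTo n (edgesAt u) ⟩
      ∑< n (edgesAt u) ∎)) (∑<-edgesAt u<n))
      where
      open ≡-Reasoning
      touches : ℕ × ℕ → Bool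
      touches e = (proj₁ e ≡ᵇ u) ∨ (proj₂ e ≡ᵇ u)

    initial-invariant : Invariant d 0 (initial d)
    initial-invariant = record
      { length-cliques = trans (length-map _ V) (trans (length-upTo n) (cong (λ m → suc (suc m)) (sym (+-identityʳ d))))
      ; cliques-wf     = map⁺ (applyUpTo⁺₁ (λ x → x) n initialClique-wf)
      ; edges-wf       = concat⁺ (map⁺ (applyUpTo⁺₁ (λ x → x) n (λ i<n →
                         map⁺ (applyUpTo⁺₁ (λ x → x) _ (λ j<i → <-trans j<i i<n , i<n)))))
      ; memberships≡   = λ u u<n → trans (cong (_+ d * d) (memberships-initial u<n))
                         (trans (solve 1 (λ d → (con 1 :+ d) :+ d :* d := d :* (con 1 :+ d) :+ con 1) refl d)
                                (cong (λ g → d * g + 1) (sym (degree-initial u<n))))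
      ; degree≥        = λ u u<n → ≤-reflexive (sym (degree-initial u<n))
      }

module DegreeCounts where

  open import Defs
  open Counting
  open CliqueInvariant
  open import Data.Bool.Base using (Bool; true; false)
  open import Data.List.Base using (List; length)
  open import Data.List.Relation.Unary.All using (All)
  open import Data.Nat.Base
  open import Data.Nat.Properties
  open import Data.Nat.Solver using (module +-*-Solver)
  open import Data.Product using (_,_; proj₁)
  open import Relation.Binary.PropositionalEquality
  open +-*-Solver
  open import Algebra.Properties.CommutativeSemigroup +-commutativeSemigroup using (xy∙z≈xz∙y)

  private
    variable
      A : Set

  𝕀-degree-bump : ∀ g m k → m ≤ 1 → 𝕀 (g + m ≡ᵇ k) + m * 𝕀 (g ≡ᵇ k) ≡ 𝕀 (g ≡ᵇ k) + m * 𝕀 (suc g ≡ᵇ k)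
  𝕀-degree-bump g zero          k _ rewrite +-identityʳ g = refl
  𝕀-degree-bump g (suc zero)    k _ rewrite +-comm g 1 =
    solve 2 (λ a b → a :+ con 1 :* b := b :+ con 1 :* a) refl (𝕀 (suc g ≡ᵇ k)) (𝕀 (g ≡ᵇ k))
  𝕀-degree-bump g (suc (suc m)) k (s≤s ())

  -- Choosing c moves every vertex of c one degree up and adds a vertex of degree d+1.
  N-step : ∀ {d t s} c j → Invariant d t s → IsClique d (nv s) c →
    N (suc j) (step s c) + count (λ x → degree s x ≡ᵇ suc j) c ≡ N (suc j) s + count (λ x → degree s x ≡ᵇ j) c + 𝕀 (d ≡ᵇ j)
  N-step {d} {t} {s} c j I (c<n , simple , |c|≡) = begin
    N k (step s c) + count Pk c
      ≡⟨ cong₂ _+_ (N≡∑< k (step s c)) (count-by-vertex n c Pk c<n) ⟩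
    (∑[ u < n ] 𝕀 (degree s′ u ≡ᵇ k) + 𝕀 (degree s′ n ≡ᵇ k)) + ∑[ u < n ] (occ u c * 𝕀 (Pk u))
      ≡⟨ cong (λ g → (∑[ u < n ] 𝕀 (degree s′ u ≡ᵇ k) + 𝕀 (g ≡ᵇ k)) + ∑[ u < n ] (occ u c * 𝕀 (Pk u)))
              (degree-new I c (c<n , simple , |c|≡)) ⟩
    (∑[ u < n ] 𝕀 (degree s′ u ≡ᵇ k) + 𝕀 (d ≡ᵇ j)) + ∑[ u < n ] (occ u c * 𝕀 (Pk u))
      ≡⟨ xy∙z≈xz∙y (∑[ u < n ] 𝕀 (degree s′ u ≡ᵇ k)) (𝕀 (d ≡ᵇ j)) _ ⟩
    ∑[ u < n ] 𝕀 (degree s′ u ≡ᵇ k) + ∑[ u < n ] (occ u c * 𝕀 (Pk u)) + 𝕀 (d ≡ᵇ j)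
      ≡⟨ cong (_+ 𝕀 (d ≡ᵇ j)) (sym (∑<-+ n _ _)) ⟩
    ∑[ u < n ] (𝕀 (degree s′ u ≡ᵇ k) + occ u c * 𝕀 (Pk u)) + 𝕀 (d ≡ᵇ j)
      ≡⟨ cong (_+ 𝕀 (d ≡ᵇ j)) (∑<-cong n (λ u u<n →
           trans (cong (λ g → 𝕀 (g ≡ᵇ k) + occ u c * 𝕀 (Pk u)) (degree-step-old s c u<n))
                 (𝕀-degree-bump (degree s u) (occ u c) k (simple u)))) ⟩
    ∑[ u < n ] (𝕀 (degree s u ≡ᵇ k) + occ u c * 𝕀 (Pj u)) + 𝕀 (d ≡ᵇ j)
      ≡⟨ cong (_+ 𝕀 (d ≡ᵇ j)) (∑<-+ n _ _) ⟩
    ∑[ u < n ] 𝕀 (degree s u ≡ᵇ k) + ∑[ u < n ] (occ u c * 𝕀 (Pj u)) + 𝕀 (d ≡ᵇ j)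
      ≡⟨ cong (_+ 𝕀 (d ≡ᵇ j)) (sym (cong₂ _+_ (N≡∑< k s) (count-by-vertex n c Pj c<n))) ⟩
    N k s + count Pj c + 𝕀 (d ≡ᵇ j) ∎
    where
    open ≡-Reasoning
    k  = suc j
    n  = nv s
    s′ = step s c
    Pk Pj : ℕ → Bool
    Pk x = degree s x ≡ᵇ k
    Pj x = degree s x ≡ᵇ j

  incidences : State → ℕ → ℕ
  incidences s m = ∑[ c ∈ cliques s ] count (λ x → degree s x ≡ᵇ m) c

  ∑-pointwise-affine : ∀ {P : A → Set} (xs : List A) (f g h : A → ℕ) a b → All P xs →
    (∀ x → P x → f x + g x ≡ a + h x + b) →
    ∑ xs f + ∑ xs g ≡ length xs * a + ∑ xs h + length xs * b
  ∑-pointwise-affine xs f g h a b Pxs f+g≡ = begin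
    ∑ xs f + ∑ xs g                           ≡⟨ sym (∑-+ xs f g) ⟩
    ∑[ x ∈ xs ] (f x + g x)                   ≡⟨ ∑-cong-All Pxs f+g≡ ⟩
    ∑[ x ∈ xs ] (a + h x + b)                 ≡⟨ ∑-+ xs (λ x → a + h x) (λ _ → b) ⟩
    ∑[ x ∈ xs ] (a + h x) + ∑[ _ ∈ xs ] b     ≡⟨ cong₂ _+_ (∑-+ xs (λ _ → a) h) (∑-const xs b) ⟩
    ∑[ _ ∈ xs ] a + ∑ xs h + length xs * b    ≡⟨ cong (λ z → z + ∑ xs h + length xs * b) (∑-const xs a) ⟩
    length xs * a + ∑ xs h + length xs * b    ∎
    where open ≡-Reasoning

  ∑-N-step : ∀ {d t s} j → Invariant d t s →
    ∑[ c ∈ cliques s ] N (suc j) (step s c) + incidences s (suc j)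
      ≡ length (cliques s) * N (suc j) s + incidences s j + length (cliques s) * 𝕀 (d ≡ᵇ j)
  ∑-N-step {s = s} j I = ∑-pointwise-affine (cliques s) _ _ _ _ _ (cliques-wf I) (λ c c-wf → N-step c j I c-wf)

  incidences-memberships : ∀ {d t s} m → Invariant d t s → incidences s m + d * d * N m s ≡ (d * m + 1) * N m s
  incidences-memberships {d} {t} {s} m I = begin
    incidences s m + d * d * N m s
      ≡⟨ cong₂ _+_ by-vertex (cong (d * d *_) (N≡∑< m s)) ⟩
    ∑[ u < n ] (memberships s u * 𝕀 (P u)) + d * d * ∑[ u < n ] 𝕀 (P u)
      ≡⟨ cong (∑[ u < n ] (memberships s u * 𝕀 (P u)) +_) (sym (∑<-*ˡ n (d * d) _)) ⟩
    ∑[ u < n ] (memberships s u * 𝕀 (P u)) + ∑[ u < n ] (d * d * 𝕀 (P u))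
      ≡⟨ sym (∑<-+ n _ _) ⟩
    ∑[ u < n ] (memberships s u * 𝕀 (P u) + d * d * 𝕀 (P u))
      ≡⟨ ∑<-cong n vertexwise ⟩
    ∑[ u < n ] ((d * m + 1) * 𝕀 (P u))
      ≡⟨ ∑<-*ˡ n (d * m + 1) (λ u → 𝕀 (P u)) ⟩
    (d * m + 1) * ∑[ u < n ] 𝕀 (P u)
      ≡⟨ cong ((d * m + 1) *_) (sym (N≡∑< m s)) ⟩
    (d * m + 1) * N m s ∎
    where
    open ≡-Reasoning
    n = nv s
    P : ℕ → Bool
    P x = degree s x ≡ᵇ m
    by-vertex : incidences s m ≡ ∑[ u < n ] (memberships s u * 𝕀 (P u))
    by-vertex = trans (∑-cong-All (cliques-wf I) (λ c c-wf → count-by-vertex n c P (proj₁ c-wf)))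
                (trans (∑-∑<-comm (cliques s) n _)
                (∑<-cong n (λ u _ → ∑-*ʳ (cliques s) (occ u) (𝕀 (P u)))))
    vertexwise : ∀ u → u < n → memberships s u * 𝕀 (P u) + d * d * 𝕀 (P u) ≡ (d * m + 1) * 𝕀 (P u)
    vertexwise u u<n with degree s u ≡ᵇ m in deg≡m
    ... | false = trans (cong₂ _+_ (*-zeroʳ (memberships s u)) (*-zeroʳ (d * d))) (sym (*-zeroʳ (d * m + 1)))
    ... | true  = trans (cong₂ _+_ (*-identityʳ (memberships s u)) (*-identityʳ (d * d)))
                  (trans (memberships≡ I u u<n)
                  (trans (cong (λ g → d * g + 1) (≡ᵇ-true⇒≡ _ _ deg≡m)) (sym (*-identityʳ (d * m + 1)))))

  -- The number of cliques through a vertex of degree m (see memberships≡); the subtraction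
  -- never truncates for m ≥ d, and every vertex has degree ≥ d+1.
  α : ℕ → ℕ → ℕ
  α d m = d * m + 1 ∸ d * d

  incidences≡α*N : ∀ {d t s} m → Invariant d t s → incidences s m ≡ α d m * N m s
  incidences≡α*N {d} {t} {s} m I = begin
    incidences s m                                       ≡⟨ sym (m+n∸n≡m _ (d * d * N m s)) ⟩
    incidences s m + d * d * N m s ∸ d * d * N m s       ≡⟨ cong (_∸ d * d * N m s) (incidences-memberships m I) ⟩
    (d * m + 1) * N m s ∸ d * d * N m s                  ≡⟨ sym (*-distribʳ-∸ (N m s) (d * m + 1) (d * d)) ⟩
    α d m * N m s                                        ∎
    where open ≡-Reasoning

  N-below-min-degree : ∀ {d t s} → Invariant d t s → N d s ≡ 0
  N-below-min-degree {d} {t} {s} I = trans (N≡∑< d s) (∑<-zero (nv s) _ (λ u u<n →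
    cong 𝕀 (≢⇒≡ᵇ-false (degree s u) d (>⇒≢ (degree≥ I u u<n)))))

module RationalFacts where

  open import Data.Nat.Base as ℕ using (ℕ; suc; s≤s)
  import Data.Nat.Properties as ℕ
  open import Data.Nat.Coprimality as Coprime using (1-coprimeTo)
  open import Data.Integer.Base as ℤ using (+_; -[1+_])
  import Data.Integer.Properties as ℤ
  open import Data.Rational
  open import Data.Rational.Properties
  open import Data.Rational.Unnormalised.Base using (mkℚᵘ; *≡*)
  open import Data.Product using (∃; _,_)
  open import Relation.Binary.PropositionalEquality

  ι : ℕ → ℚ
  ι n = + n / 1

  1/suc : ℕ → ℚ
  1/suc n = + 1 / suc n

  private
    ι≡mkℚ : ∀ n → ι n ≡ mkℚ (+ n) 0 (Coprime.sym (1-coprimeTo n))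
    ι≡mkℚ n = normalize-coprime (Coprime.sym (1-coprimeTo n))

    1/suc≡mkℚ : ∀ n → 1/suc n ≡ mkℚ (+ 1) n (1-coprimeTo (suc n))
    1/suc≡mkℚ n = normalize-coprime (1-coprimeTo (suc n))

    /-cross : ∀ i j m n → i ℤ.* + suc n ≡ j ℤ.* + suc m → i / suc m ≡ j / suc n
    /-cross i j m n e = fromℚᵘ-cong {mkℚᵘ i m} {mkℚᵘ j n} (*≡* e)

  ι-+ : ∀ m n → ι (m ℕ.+ n) ≡ ι m + ι n
  ι-+ m n rewrite ι≡mkℚ m | ι≡mkℚ n = /-cross (+ (m ℕ.+ n)) (+ m ℤ.* + 1 ℤ.+ + n ℤ.* + 1) 0 0
    (cong (ℤ._* + 1) (trans (ℤ.pos-+ m n) (cong₂ ℤ._+_ (sym (ℤ.*-identityʳ (+ m))) (sym (ℤ.*-identityʳ (+ n))))))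

  ι-* : ∀ m n → ι (m ℕ.* n) ≡ ι m * ι n
  ι-* m n rewrite ι≡mkℚ m | ι≡mkℚ n = /-cross (+ (m ℕ.* n)) (+ m ℤ.* + n) 0 0 (cong (ℤ._* + 1) (ℤ.pos-* m n))

  ι-suc*1/suc : ∀ n → ι (suc n) * 1/suc n ≡ 1ℚ
  ι-suc*1/suc n rewrite ι≡mkℚ (suc n) | 1/suc≡mkℚ n = /-cross (+ suc n ℤ.* + 1) (+ 1) (n ℕ.+ 0 ℕ.* suc n) 0
    (trans (ℤ.*-identityʳ _) (trans (ℤ.*-identityʳ _)
      (trans (cong (λ m → + suc m) (sym (ℕ.+-identityʳ n))) (sym (ℤ.*-identityˡ _)))))

  /suc≡ι*1/suc : ∀ a n → + a / suc n ≡ ι a * 1/suc n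
  /suc≡ι*1/suc a n rewrite ι≡mkℚ a | 1/suc≡mkℚ n = /-cross (+ a) (+ a ℤ.* + 1) n (n ℕ.+ 0)
    (trans (cong (λ m → + a ℤ.* + suc m) (ℕ.+-identityʳ n)) (cong (ℤ._* + suc n) (sym (ℤ.*-identityʳ (+ a)))))

  ι-nonNeg : ∀ n → 0ℚ ≤ ι n
  ι-nonNeg n = nonNegative⁻¹ (ι n) {{normalize-nonNeg n 1}}

  ι-suc-pos : ∀ n → 0ℚ < ι (suc n)
  ι-suc-pos n = positive⁻¹ (ι (suc n)) {{normalize-pos (suc n) 1}}

  1/suc-nonNeg : ∀ n → 0ℚ ≤ 1/suc n
  1/suc-nonNeg n = nonNegative⁻¹ (1/suc n) {{normalize-nonNeg 1 (suc n)}}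

  1/suc-pos : ∀ n → 0ℚ < 1/suc n
  1/suc-pos n = positive⁻¹ (1/suc n) {{normalize-pos 1 (suc n)}}

  ι-mono-≤ : ∀ {m n} → m ℕ.≤ n → ι m ≤ ι n
  ι-mono-≤ {m} {n} m≤n = subst (ι m ≤_) (trans (sym (ι-+ m (n ℕ.∸ m))) (cong ι (ℕ.m+[n∸m]≡n m≤n)))
    (subst (_≤ ι m + ι (n ℕ.∸ m)) (+-identityʳ (ι m)) (+-monoʳ-≤ (ι m) (ι-nonNeg (n ℕ.∸ m))))

  ι-mono-< : ∀ {m n} → m ℕ.< n → ι m < ι n
  ι-mono-< {m} {suc n} (s≤s m≤n) = subst (ι m <_) (trans (sym (ι-+ m (suc (n ℕ.∸ m))))
      (cong ι (trans (ℕ.+-suc m (n ℕ.∸ m)) (cong suc (ℕ.m+[n∸m]≡n m≤n)))))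
    (subst (_< ι m + ι (suc (n ℕ.∸ m))) (+-identityʳ (ι m)) (+-monoʳ-< (ι m) (ι-suc-pos (n ℕ.∸ m))))

  archimedean : ∀ q → ∃ λ M → q < ι M
  archimedean q@(mkℚ (+ a) dm _) = suc a , ≤-<-trans q≤a (ι-mono-< (ℕ.n<1+n a))
    where
    q≤a : q ≤ ι a
    q≤a rewrite ι≡mkℚ a = *≤* (subst₂ ℤ._≤_ (ℤ.pos-* a 1) (ℤ.pos-* a (suc dm))
      (ℤ.+≤+ (subst (ℕ._≤ a ℕ.* suc dm) (sym (ℕ.*-identityʳ a)) (ℕ.m≤m*n a (suc dm)))))
  archimedean q@(mkℚ -[1+ _ ] _ _) = 1 , <-trans (negative⁻¹ q) (ι-suc-pos 0)

module Convergence where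

  open RationalFacts
  open import Data.Nat.Base as ℕ using (ℕ; zero; suc; z≤n; s≤s)
  import Data.Nat.Properties as ℕ
  open import Data.Rational
  open import Data.Rational.Properties
  open import Data.Rational.Solver using (module +-*-Solver)
  open import Data.Product using (∃; _,_; proj₁; proj₂)
  open import Data.Sum using (inj₁; inj₂)
  open import Relation.Binary.PropositionalEquality
  open import Relation.Nullary using (yes; no)
  open +-*-Solver

  *-monoˡ-≤-≥0 : ∀ {p q} r → 0ℚ ≤ r → p ≤ q → p * r ≤ q * r
  *-monoˡ-≤-≥0 r 0≤r = *-monoʳ-≤-nonNeg r {{nonNegative 0≤r}}

  *-monoʳ-≤-≥0 : ∀ {p q} r → 0ℚ ≤ r → p ≤ q → r * p ≤ r * q
  *-monoʳ-≤-≥0 r 0≤r = *-monoˡ-≤-nonNeg r {{nonNegative 0≤r}}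

  ∣p*q∣≡∣p∣*q : ∀ p {q} → 0ℚ ≤ q → ∣ p * q ∣ ≡ ∣ p ∣ * q
  ∣p*q∣≡∣p∣*q p {q} 0≤q = trans (∣p*q∣≡∣p∣*∣q∣ p q) (cong (∣ p ∣ *_) (0≤p⇒∣p∣≡p 0≤q))

  maxUpTo : (ℕ → ℚ) → ℕ → ℚ
  maxUpTo f zero    = f 0
  maxUpTo f (suc m) = maxUpTo f m ⊔ f (suc m)

  ≤-maxUpTo : ∀ f {m t} → t ℕ.≤ m → f t ≤ maxUpTo f m
  ≤-maxUpTo f {zero}  z≤n = ≤-refl
  ≤-maxUpTo f {suc m} t≤1+m with ℕ.m≤n⇒m<n∨m≡n t≤1+m
  ... | inj₁ (s≤s t≤m) = p≤q⇒p≤q⊔r (f (suc m)) (≤-maxUpTo f t≤m)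
  ... | inj₂ refl      = p≤q⇒p≤r⊔q (maxUpTo f m) ≤-refl

  -- Once b i_t ≤ 1, |z_{t+1}| ≤ (1 − b i_t) |z_t| + b i_t (K / b) is a convex combination, so the
  -- bound B = max(|z_0|, …, |z_T|, K) persists.
  contraction-bounded : ∀ (z g i : ℕ → ℚ) (b K : ℚ) T → 1ℚ ≤ b → (∀ t → 0ℚ ≤ i t) →
    (∀ t → T ℕ.≤ t → b * i t ≤ 1ℚ) → (∀ t → ∣ g t ∣ ≤ K) →
    (∀ t → z (suc t) ≡ z t * (1ℚ - b * i t) + g t * i t) →
    ∃ λ B → ∀ t → ∣ z t ∣ ≤ B
  contraction-bounded z g i b K T 1≤b i≥0 bi≤1 ∣g∣≤K z-step = B , bounded
    where
    ∣z∣ : ℕ → ℚ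
    ∣z∣ t = ∣ z t ∣
    B = maxUpTo ∣z∣ T ⊔ K

    K≤B : K ≤ B
    K≤B = p≤q⇒p≤r⊔q (maxUpTo ∣z∣ T) ≤-refl

    B≥0 : 0ℚ ≤ B
    B≥0 = ≤-trans (0≤∣p∣ (z 0)) (p≤q⇒p≤q⊔r K (≤-maxUpTo ∣z∣ {T} z≤n))

    K≤B*b : K ≤ B * b
    K≤B*b = ≤-trans K≤B (subst (_≤ B * b) (*-identityʳ B) (*-monoʳ-≤-≥0 B B≥0 1≤b))

    step-bounded : ∀ t → T ℕ.≤ t → ∣ z t ∣ ≤ B → ∣ z (suc t) ∣ ≤ B
    step-bounded t T≤t ∣zt∣≤B = begin
      ∣ z (suc t) ∣                      ≡⟨ cong ∣_∣ (z-step t) ⟩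
      ∣ z t * F + g t * i t ∣            ≤⟨ ∣p+q∣≤∣p∣+∣q∣ (z t * F) (g t * i t) ⟩
      ∣ z t * F ∣ + ∣ g t * i t ∣        ≡⟨ cong₂ _+_ (∣p*q∣≡∣p∣*q (z t) F≥0) (∣p*q∣≡∣p∣*q (g t) (i≥0 t)) ⟩
      ∣ z t ∣ * F + ∣ g t ∣ * i t        ≤⟨ +-mono-≤ (*-monoˡ-≤-≥0 F F≥0 ∣zt∣≤B)
                                                     (*-monoˡ-≤-≥0 (i t) (i≥0 t) (≤-trans (∣g∣≤K t) K≤B*b)) ⟩
      B * F + (B * b) * i t              ≡⟨ solve 3 (λ B b i → B :* (con 1ℚ :- b :* i) :+ (B :* b) :* i := B) refl B b (i t) ⟩
      B                                  ∎
      where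
      open ≤-Reasoning
      F = 1ℚ - b * i t
      F≥0 : 0ℚ ≤ F
      F≥0 = subst (_≤ F) (+-inverseʳ (b * i t)) (+-monoˡ-≤ (- (b * i t)) (bi≤1 t T≤t))

    bounded-from-T : ∀ m → ∣ z (T ℕ.+ m) ∣ ≤ B
    bounded-from-T zero    = subst (λ u → ∣ z u ∣ ≤ B) (sym (ℕ.+-identityʳ T)) (p≤q⇒p≤q⊔r K (≤-maxUpTo ∣z∣ ℕ.≤-refl))
    bounded-from-T (suc m) = subst (λ u → ∣ z u ∣ ≤ B) (sym (ℕ.+-suc T m))
      (step-bounded (T ℕ.+ m) (ℕ.m≤m+n T m) (bounded-from-T m))

    bounded : ∀ t → ∣ z t ∣ ≤ B
    bounded t with t ℕ.≤? T
    ... | yes t≤T = p≤q⇒p≤q⊔r K (≤-maxUpTo ∣z∣ t≤T)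
    ... | no  t≰T = subst (λ u → ∣ z u ∣ ≤ B) (ℕ.m+[n∸m]≡n (ℕ.<⇒≤ (ℕ.≰⇒> t≰T))) (bounded-from-T (t ℕ.∸ T))

  bounded-deviation⇒ratio-limit : ∀ (x : ℕ → ℚ) (n : ℕ → ℕ) P B → (∀ t → t ℕ.≤ n t) →
    (∀ t → ∣ x t - P * ι (suc (n t)) ∣ ≤ B) →
    ∀ ε → 0ℚ < ε → ∃ λ T → ∀ t → T ℕ.≤ t → ∣ x t * 1/suc (n t) - P ∣ < ε
  bounded-deviation⇒ratio-limit x n P B t≤n ∣x-Pn∣≤B ε ε>0 = M , close
    where
    instance
      ε≢0 : NonZero ε
      ε≢0 = pos⇒nonZero ε {{positive ε>0}}
    M = proj₁ (archimedean (B * 1/ ε))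

    close : ∀ t → M ℕ.≤ t → ∣ x t * 1/suc (n t) - P ∣ < ε
    close t M≤t = begin-strict
      ∣ x t * i - P ∣                 ≡⟨ cong ∣_∣ deviation-scaled ⟩
      ∣ (x t - P * N) * i ∣           ≡⟨ ∣p*q∣≡∣p∣*q (x t - P * N) (1/suc-nonNeg (n t)) ⟩
      ∣ x t - P * N ∣ * i             ≤⟨ *-monoˡ-≤-≥0 i (1/suc-nonNeg (n t)) (∣x-Pn∣≤B t) ⟩
      B * i                           ≡⟨ sym rescaled ⟩
      (B * 1/ ε) * (ε * i)            <⟨ *-monoˡ-<-pos (ε * i) {{positive εi>0}}
                                            (<-≤-trans (proj₂ (archimedean (B * 1/ ε))) (ι-mono-≤ M≤N)) ⟩
      N * (ε * i)                     ≡⟨ trans (solve 3 (λ N ε i → N :* (ε :* i) := ε :* (N :* i)) refl N ε i)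
                                                (trans (cong (ε *_) (ι-suc*1/suc (n t))) (*-identityʳ ε)) ⟩
      ε                               ∎
      where
      open ≤-Reasoning
      i = 1/suc (n t)
      N = ι (suc (n t))
      M≤N : M ℕ.≤ suc (n t)
      M≤N = ℕ.m≤n⇒m≤1+n (ℕ.≤-trans M≤t (t≤n t))
      deviation-scaled : x t * i - P ≡ (x t - P * N) * i
      deviation-scaled = trans (solve 4 (λ x P N i → x :* i :- P := (x :- P :* N) :* i :+ P :* (N :* i :- con 1ℚ)) refl (x t) P N i)
        (trans (cong (λ u → (x t - P * N) * i + P * (u - 1ℚ)) (ι-suc*1/suc (n t)))
               (solve 2 (λ m P → m :+ P :* (con 1ℚ :- con 1ℚ) := m) refl ((x t - P * N) * i) P))
      rescaled : (B * 1/ ε) * (ε * i) ≡ B * i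
      rescaled = trans (solve 4 (λ B e ε i → (B :* e) :* (ε :* i) := B :* i :* (e :* ε)) refl B (1/ ε) ε i)
                       (trans (cong (B * i *_) (*-inverseˡ ε)) (*-identityʳ _))
      εi>0 : 0ℚ < ε * i
      εi>0 = subst (_< ε * i) (*-zeroˡ i) (*-monoˡ-<-pos i {{positive (1/suc-pos (n t))}} ε>0)

module Expectation where

  open import Defs
  open Counting
  open CliqueInvariant
  open RationalFacts
  open import Data.Nat.Base as ℕ using (ℕ; zero; suc)
  import Data.Nat.Properties as ℕ
  open import Data.Rational
  open import Data.Rational.Properties
  open import Data.Rational.Solver using (module +-*-Solver)
  open import Data.List.Base using ([]; _∷_; map; length)
  open import Data.List.Properties using (length-map; map-cong)
  open import Data.List.Relation.Unary.All using (All; []; _∷_)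
  open import Relation.Binary.PropositionalEquality
  open +-*-Solver

  private
    variable
      A : Set

  map-cong-All : ∀ {B : Set} {P : A → Set} {f g : A → B} {xs} → All P xs → (∀ x → P x → f x ≡ g x) → map f xs ≡ map g xs
  map-cong-All []         f≗g = refl
  map-cong-All (px ∷ pxs) f≗g = cong₂ _∷_ (f≗g _ px) (map-cong-All pxs f≗g)

  avg≡sum*1/suc : ∀ (h : A → ℚ) xs K → length xs ≡ suc K → avg (map h xs) ≡ sumℚ (map h xs) * 1/suc K
  avg≡sum*1/suc h (x ∷ xs) K |xs|≡ = cong (λ n → sumℚ (map h (x ∷ xs)) * 1/suc n) (trans (length-map h xs) (ℕ.suc-injective |xs|≡))

  sumℚ-ι : ∀ (g : A → ℕ) xs → sumℚ (map (λ x → ι (g x)) xs) ≡ ι (∑ xs g)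
  sumℚ-ι g []       = refl
  sumℚ-ι g (x ∷ xs) = trans (cong (ι (g x) +_) (sumℚ-ι g xs)) (sym (ι-+ (g x) (∑ xs g)))

  sumℚ-affine : ∀ (f g : A → ℚ) p q c xs →
    sumℚ (map (λ x → p * f x + q * g x + c) xs) ≡ p * sumℚ (map f xs) + q * sumℚ (map g xs) + ι (length xs) * c
  sumℚ-affine f g p q c []       = solve 3 (λ p q c → con 0ℚ := p :* con 0ℚ :+ q :* con 0ℚ :+ con 0ℚ :* c) refl p q c
  sumℚ-affine f g p q c (x ∷ xs) = begin
    (p * f x + q * g x + c) + sumℚ (map (λ x → p * f x + q * g x + c) xs)
      ≡⟨ cong ((p * f x + q * g x + c) +_) (sumℚ-affine f g p q c xs) ⟩
    (p * f x + q * g x + c) + (p * F + q * G + L * c)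
      ≡⟨ solve 8 (λ p q c fx gx F G L → (p :* fx :+ q :* gx :+ c) :+ (p :* F :+ q :* G :+ L :* c)
                      := p :* (fx :+ F) :+ q :* (gx :+ G) :+ (con 1ℚ :+ L) :* c) refl p q c (f x) (g x) F G L ⟩
    p * (f x + F) + q * (g x + G) + (1ℚ + L) * c
      ≡⟨ cong (λ u → p * (f x + F) + q * (g x + G) + u * c) (sym (ι-+ 1 (length xs))) ⟩
    p * (f x + F) + q * (g x + G) + ι (suc (length xs)) * c ∎
    where
    open ≡-Reasoning
    F = sumℚ (map f xs)
    G = sumℚ (map g xs)
    L = ι (length xs)

  avg-affine : ∀ (f g : A → ℚ) p q c xs K → length xs ≡ suc K →
    avg (map (λ x → p * f x + q * g x + c) xs) ≡ p * avg (map f xs) + q * avg (map g xs) + c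
  avg-affine f g p q c xs K |xs|≡ = begin
    avg (map (λ x → p * f x + q * g x + c) xs)
      ≡⟨ avg≡sum*1/suc _ xs K |xs|≡ ⟩
    sumℚ (map (λ x → p * f x + q * g x + c) xs) * i
      ≡⟨ cong (_* i) (sumℚ-affine f g p q c xs) ⟩
    (p * F + q * G + ι (length xs) * c) * i
      ≡⟨ cong (λ n → (p * F + q * G + ι n * c) * i) |xs|≡ ⟩
    (p * F + q * G + ι (suc K) * c) * i
      ≡⟨ solve 7 (λ p q c F G L i → (p :* F :+ q :* G :+ L :* c) :* i := p :* (F :* i) :+ q :* (G :* i) :+ c :* (L :* i))
                 refl p q c F G (ι (suc K)) i ⟩
    p * (F * i) + q * (G * i) + c * (ι (suc K) * i)
      ≡⟨ cong₂ (λ u v → p * u + q * v + c * (ι (suc K) * i))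
               (sym (avg≡sum*1/suc f xs K |xs|≡)) (sym (avg≡sum*1/suc g xs K |xs|≡)) ⟩
    p * avg (map f xs) + q * avg (map g xs) + c * (ι (suc K) * i)
      ≡⟨ cong (λ u → p * avg (map f xs) + q * avg (map g xs) + c * u) (ι-suc*1/suc K) ⟩
    p * avg (map f xs) + q * avg (map g xs) + c * 1ℚ
      ≡⟨ cong (p * avg (map f xs) + q * avg (map g xs) +_) (*-identityʳ c) ⟩
    p * avg (map f xs) + q * avg (map g xs) + c ∎
    where
    open ≡-Reasoning
    i = 1/suc K
    F = sumℚ (map f xs)
    G = sumℚ (map g xs)

  expect-suc : ∀ t s f → expect (suc t) s f ≡ expect t s (λ s′ → expect 1 s′ f)
  expect-suc zero    s f = refl
  expect-suc (suc t) s f = cong avg (map-cong (λ c → expect-suc t (step s c) f) (cliques s))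

  module _ (d : ℕ) where

    expect-cong : ∀ t m s (f g : State → ℚ) → Invariant d m s →
      (∀ s′ → Invariant d (t ℕ.+ m) s′ → f s′ ≡ g s′) → expect t s f ≡ expect t s g
    expect-cong zero    m s f g I f≗g = f≗g s I
    expect-cong (suc t) m s f g I f≗g = cong avg (map-cong-All (cliques-wf I) (λ c c-wf →
      expect-cong t (suc m) (step s c) f g (step-preserves I c c-wf)
        (λ s′ I′ → f≗g s′ (subst (λ k → Invariant d k s′) (ℕ.+-suc t m) I′))))

    expect-affine : ∀ t m s (f g : State → ℚ) p q c → Invariant d m s →
      expect t s (λ s′ → p * f s′ + q * g s′ + c) ≡ p * expect t s f + q * expect t s g + c
    expect-affine zero    m s f g p q c I = refl
    expect-affine (suc t) m s f g p q c I = trans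
      (cong avg (map-cong-All (cliques-wf I) (λ c′ c′-wf → expect-affine t (suc m) (step s c′) f g p q c (step-preserves I c′ c′-wf))))
      (avg-affine (λ c′ → expect t (step s c′) f) (λ c′ → expect t (step s c′) g) p q c (cliques s) _ (length-cliques I))

    expect-initial-cong : ∀ t (f g : State → ℚ) → (∀ s → Invariant d t s → f s ≡ g s) →
      expect t (initial d) f ≡ expect t (initial d) g
    expect-initial-cong t f g f≗g = expect-cong t 0 (initial d) f g (initial-invariant d)
      (λ s I → f≗g s (subst (λ k → Invariant d k s) (ℕ.+-identityʳ t) I))

    expect-initial-affine : ∀ t (f g : State → ℚ) p q c →
      expect t (initial d) (λ s → p * f s + q * g s + c) ≡ p * expect t (initial d) f + q * expect t (initial d) g + c
    expect-initial-affine t f g p q c = expect-affine t 0 (initial d) f g p q c (initial-invariant d)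

module DegreeRecurrence where

  open import Defs
  open Counting
  open CliqueInvariant
  open DegreeCounts
  open RationalFacts
  open Expectation
  open import Data.Nat.Base as ℕ using (ℕ; suc; _≡ᵇ_)
  open import Data.Rational
  open import Data.Rational.Solver using (module +-*-Solver)
  open import Data.List.Base using (map; length)
  open import Relation.Binary.PropositionalEquality
  open +-*-Solver

  module _ (d : ℕ) where

    1/#cliques : ℕ → ℚ
    1/#cliques t = 1/suc (suc (d ℕ.+ t ℕ.* suc d))

    ι-#cliques*1/#cliques : ∀ t → ι (#cliques d t) * 1/#cliques t ≡ 1ℚ
    ι-#cliques*1/#cliques t = ι-suc*1/suc (suc (d ℕ.+ t ℕ.* suc d))

    1/#cliques-nonNeg : ∀ t → 0ℚ ≤ 1/#cliques t
    1/#cliques-nonNeg t = 1/suc-nonNeg (suc (d ℕ.+ t ℕ.* suc d))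

    ι-∑-N-step : ∀ {t s} j → Invariant d t s →
      ι (∑[ c ∈ cliques s ] N (suc j) (step s c)) + ι (α d (suc j)) * ι (N (suc j) s)
        ≡ ι (length (cliques s)) * ι (N (suc j) s) + ι (α d j) * ι (N j s) + ι (length (cliques s)) * ι (𝕀 (d ≡ᵇ j))
    ι-∑-N-step {t} {s} j I = begin
      ι S + ι (α d (suc j)) * ι (N (suc j) s)
        ≡⟨ cong (ι S +_) (sym (ι-* (α d (suc j)) (N (suc j) s))) ⟩
      ι S + ι (α d (suc j) ℕ.* N (suc j) s)
        ≡⟨ sym (ι-+ S (α d (suc j) ℕ.* N (suc j) s)) ⟩
      ι (S ℕ.+ α d (suc j) ℕ.* N (suc j) s)
        ≡⟨ cong ι counted ⟩
      ι (L ℕ.* N (suc j) s ℕ.+ α d j ℕ.* N j s ℕ.+ L ℕ.* 𝕀 (d ≡ᵇ j))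
        ≡⟨ trans (ι-+ (L ℕ.* N (suc j) s ℕ.+ α d j ℕ.* N j s) (L ℕ.* 𝕀 (d ≡ᵇ j)))
                 (cong₂ _+_ (trans (ι-+ (L ℕ.* N (suc j) s) (α d j ℕ.* N j s)) (cong₂ _+_ (ι-* L (N (suc j) s)) (ι-* (α d j) (N j s))))
                            (ι-* L (𝕀 (d ≡ᵇ j)))) ⟩
      ι L * ι (N (suc j) s) + ι (α d j) * ι (N j s) + ι L * ι (𝕀 (d ≡ᵇ j)) ∎
      where
      open ≡-Reasoning
      S = ∑[ c ∈ cliques s ] N (suc j) (step s c)
      L = length (cliques s)
      counted : S ℕ.+ α d (suc j) ℕ.* N (suc j) s ≡ L ℕ.* N (suc j) s ℕ.+ α d j ℕ.* N j s ℕ.+ L ℕ.* 𝕀 (d ≡ᵇ j)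
      counted = trans (cong (S ℕ.+_) (sym (incidences≡α*N (suc j) I)))
                (trans (∑-N-step j I) (cong (λ a → L ℕ.* N (suc j) s ℕ.+ a ℕ.+ L ℕ.* 𝕀 (d ≡ᵇ j)) (incidences≡α*N j I)))

    expect-N-step : ∀ {t s} j → Invariant d t s →
      expect 1 s (λ s′ → ι (N (suc j) s′))
        ≡ ι (N (suc j) s) + (ι (α d j) * ι (N j s) - ι (α d (suc j)) * ι (N (suc j) s)) * 1/#cliques t + ι (𝕀 (d ≡ᵇ j))
    expect-N-step {t} {s} j I = begin
      avg (map (λ c → ι (N (suc j) (step s c))) (cliques s))
        ≡⟨ avg≡sum*1/suc _ (cliques s) _ (length-cliques I) ⟩
      sumℚ (map (λ c → ι (N (suc j) (step s c))) (cliques s)) * i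
        ≡⟨ cong (_* i) (sumℚ-ι (λ c → N (suc j) (step s c)) (cliques s)) ⟩
      ι S * i
        ≡⟨ cong (_* i) (solve 3 (λ S a n → S := (S :+ a :* n) :- a :* n) refl (ι S) ak Nk) ⟩
      (ι S + ak * Nk - ak * Nk) * i
        ≡⟨ cong (λ u → (u - ak * Nk) * i) (ι-∑-N-step j I) ⟩
      (L * Nk + aj * Nj + L * δ - ak * Nk) * i
        ≡⟨ solve 7 (λ L Nk aj Nj δ ak i → (L :* Nk :+ aj :* Nj :+ L :* δ :- ak :* Nk) :* i
                     := Nk :+ (aj :* Nj :- ak :* Nk) :* i :+ δ :+ (Nk :+ δ) :* (L :* i :- con 1ℚ)) refl L Nk aj Nj δ ak i ⟩
      Nk + (aj * Nj - ak * Nk) * i + δ + (Nk + δ) * (L * i - 1ℚ)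
        ≡⟨ cong (λ u → Nk + (aj * Nj - ak * Nk) * i + δ + (Nk + δ) * (u - 1ℚ))
                (trans (cong (λ n → ι n * i) (length-cliques I)) (ι-#cliques*1/#cliques t)) ⟩
      Nk + (aj * Nj - ak * Nk) * i + δ + (Nk + δ) * (1ℚ - 1ℚ)
        ≡⟨ solve 2 (λ m x → m :+ x :* (con 1ℚ :- con 1ℚ) := m) refl (Nk + (aj * Nj - ak * Nk) * i + δ) (Nk + δ) ⟩
      Nk + (aj * Nj - ak * Nk) * i + δ ∎
      where
      open ≡-Reasoning
      i  = 1/#cliques t
      S  = ∑[ c ∈ cliques s ] N (suc j) (step s c)
      L  = ι (length (cliques s))
      Nk = ι (N (suc j) s)
      Nj = ι (N j s)
      ak = ι (α d (suc j))
      aj = ι (α d j)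
      δ  = ι (𝕀 (d ≡ᵇ j))

    EN-suc : ∀ t j → EN d (suc t) (suc j)
      ≡ EN d t (suc j) + (ι (α d j) * EN d t j - ι (α d (suc j)) * EN d t (suc j)) * 1/#cliques t + ι (𝕀 (d ≡ᵇ j))
    EN-suc t j = begin
      EN d (suc t) (suc j)
        ≡⟨ expect-suc t (initial d) Nk ⟩
      expect t (initial d) (λ s → expect 1 s Nk)
        ≡⟨ expect-initial-cong d t _ _ one-step ⟩
      expect t (initial d) (λ s → (1ℚ - ak * i) * Nk s + (aj * i) * Nj s + δ)
        ≡⟨ expect-initial-affine d t Nk Nj (1ℚ - ak * i) (aj * i) δ ⟩
      (1ℚ - ak * i) * EN d t (suc j) + (aj * i) * EN d t j + δ
        ≡⟨ sym (regroup (EN d t (suc j)) (EN d t j)) ⟩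
      EN d t (suc j) + (aj * EN d t j - ak * EN d t (suc j)) * i + δ ∎
      where
      open ≡-Reasoning
      i  = 1/#cliques t
      ak = ι (α d (suc j))
      aj = ι (α d j)
      δ  = ι (𝕀 (d ≡ᵇ j))
      Nk Nj : State → ℚ
      Nk s = ι (N (suc j) s)
      Nj s = ι (N j s)
      regroup : ∀ x y → x + (aj * y - ak * x) * i + δ ≡ (1ℚ - ak * i) * x + (aj * i) * y + δ
      regroup = solve 6 (λ ak aj i δ x y → x :+ (aj :* y :- ak :* x) :* i :+ δ := (con 1ℚ :- ak :* i) :* x :+ (aj :* i) :* y :+ δ)
                  refl ak aj i δ
      one-step : ∀ s → Invariant d t s → expect 1 s Nk ≡ (1ℚ - ak * i) * Nk s + (aj * i) * Nj s + δ
      one-step s I = trans (expect-N-step j I) (regroup (Nk s) (Nj s))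

    EN-below-min-degree : ∀ t → EN d t d ≡ 0ℚ
    EN-below-min-degree t = begin
      EN d t d                                                ≡⟨ expect-initial-cong d t _ _ vanishes ⟩
      expect t (initial d) (λ s → 0ℚ * Nd s + 0ℚ * Nd s + 0ℚ) ≡⟨ expect-initial-affine d t Nd Nd 0ℚ 0ℚ 0ℚ ⟩
      0ℚ * EN d t d + 0ℚ * EN d t d + 0ℚ                      ≡⟨ annihilate (EN d t d) ⟩
      0ℚ                                                      ∎
      where
      open ≡-Reasoning
      Nd : State → ℚ
      Nd s = ι (N d s)
      annihilate : ∀ x → 0ℚ * x + 0ℚ * x + 0ℚ ≡ 0ℚ
      annihilate = solve 1 (λ x → con 0ℚ :* x :+ con 0ℚ :* x :+ con 0ℚ := con 0ℚ) refl
      vanishes : ∀ s → Invariant d t s → Nd s ≡ 0ℚ * Nd s + 0ℚ * Nd s + 0ℚ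
      vanishes s I = trans (cong ι (N-below-min-degree I)) (sym (annihilate (Nd s)))

module Limit where

  open import Defs
  open Counting
  open CliqueInvariant using (#cliques)
  open DegreeCounts
  open RationalFacts
  open Convergence
  open DegreeRecurrence
  open import Data.Nat.Base as ℕ using (ℕ; zero; suc; _≡ᵇ_)
  import Data.Nat.Properties as ℕ
  open import Data.Integer.Base as ℤ using (+_)
  import Data.Integer.Properties as ℤ
  open import Data.Rational
  open import Data.Rational.Properties
  open import Data.Rational.Solver renaming (module +-*-Solver to ℚ-Solver)
  open import Data.Nat.Solver renaming (module +-*-Solver to ℕ-Solver)
  open import Data.Product using (∃; proj₁; proj₂)
  open import Relation.Binary.PropositionalEquality

  -- The linearisation of x′ = x + (a y − b x) i + δ around the line x = P n, given y ≈ Q n and the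
  -- fixed-point equation for P; C i = 1 and D n = C + E relate i to n.
  deviation-step : ∀ {x x′ y n n′ i} {a b δ P Q C D E} →
    x′ ≡ x + (a * y - b * x) * i + δ → n′ ≡ n + 1ℚ → C * i ≡ 1ℚ → D * n ≡ C + E →
    P * (b + D) ≡ a * Q + D * δ →
    x′ - P * n′ ≡ (x - P * n) * (1ℚ - b * i) + (a * (y - Q * n) + (P - δ) * E) * i
  deviation-step {x} {x′} {y} {n} {n′} {i} {a} {b} {δ} {P} {Q} {C} {D} {E} x′≡ n′≡ C*i≡1 D*n≡ fixed = begin
    x′ - P * n′
      ≡⟨ cong₂ (λ u v → u - P * v) x′≡ n′≡ ⟩
    (x + (a * y - b * x) * i + δ) - P * (n + 1ℚ)
      ≡⟨ rearrange x y a b δ P Q n C i D E ⟩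
    M + (P - δ) * (C * i - 1ℚ) + n * i * (a * Q + D * δ - P * (b + D)) + (P - δ) * i * (D * n - E - C)
      ≡⟨ cong₂ (λ u v → M + (P - δ) * (u - 1ℚ) + n * i * (a * Q + D * δ - v) + (P - δ) * i * (D * n - E - C)) C*i≡1 fixed ⟩
    M + (P - δ) * (1ℚ - 1ℚ) + n * i * (a * Q + D * δ - (a * Q + D * δ)) + (P - δ) * i * (D * n - E - C)
      ≡⟨ cong (λ w → M + (P - δ) * (1ℚ - 1ℚ) + n * i * (a * Q + D * δ - (a * Q + D * δ)) + (P - δ) * i * (w - E - C)) D*n≡ ⟩
    M + (P - δ) * (1ℚ - 1ℚ) + n * i * (a * Q + D * δ - (a * Q + D * δ)) + (P - δ) * i * ((C + E) - E - C)
      ≡⟨ solve 7 (λ m p n i u c e → m :+ p :* (con 1ℚ :- con 1ℚ) :+ n :* i :* (u :- u) :+ p :* i :* ((c :+ e) :- e :- c) := m)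
                 refl M (P - δ) n i (a * Q + D * δ) C E ⟩
    M ∎
    where
    open ≡-Reasoning
    open ℚ-Solver
    M = (x - P * n) * (1ℚ - b * i) + (a * (y - Q * n) + (P - δ) * E) * i
    rearrange : ∀ x y a b δ P Q n C i D E →
      (x + (a * y - b * x) * i + δ) - P * (n + 1ℚ)
        ≡ (x - P * n) * (1ℚ - b * i) + (a * (y - Q * n) + (P - δ) * E) * i
          + (P - δ) * (C * i - 1ℚ) + n * i * (a * Q + D * δ - P * (b + D)) + (P - δ) * i * (D * n - E - C)
    rearrange = solve 12 (λ x y a b δ P Q n C i D E →
      (x :+ (a :* y :- b :* x) :* i :+ δ) :- P :* (n :+ con 1ℚ)
        := (x :- P :* n) :* (con 1ℚ :- b :* i) :+ (a :* (y :- Q :* n) :+ (P :- δ) :* E) :* i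
           :+ (P :- δ) :* (C :* i :- con 1ℚ) :+ n :* i :* (a :* Q :+ D :* δ :- P :* (b :+ D)) :+ (P :- δ) :* i :* (D :* n :- E :- C))
      refl

  module _ (d : ℕ) where

    vertices : ℕ → ℚ
    vertices t = ι (suc (suc (d ℕ.+ t)))

    vertices-suc : ∀ t → vertices (suc t) ≡ vertices t + 1ℚ
    vertices-suc t = trans (cong ι (trans (cong (λ m → suc (suc m)) (ℕ.+-suc d t)) (ℕ.+-comm 1 _))) (ι-+ (suc (suc (d ℕ.+ t))) 1)

    vertices≡#cliques : ∀ t → ι (suc d) * vertices t ≡ ι (#cliques d t) + ι (d ℕ.* suc (suc d))
    vertices≡#cliques t = trans (sym (ι-* (suc d) (suc (suc (d ℕ.+ t)))))
      (trans (cong ι (solve 2 (λ d t → (con 1 :+ d) :* (con 2 :+ (d :+ t)) := (con 2 :+ (d :+ t :* (con 1 :+ d))) :+ d :* (con 2 :+ d)) refl d t))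
             (ι-+ (#cliques d t) (d ℕ.* suc (suc d))))
      where open ℕ-Solver

    ι-≤-#cliques : ∀ {a t} → a ℕ.≤ t → ι a ≤ ι (#cliques d t)
    ι-≤-#cliques {a} {t} a≤t = ι-mono-≤ (ℕ.≤-trans a≤t (ℕ.≤-trans (ℕ.m≤m*n t (suc d))
      (ℕ.≤-trans (ℕ.m≤n+m (t ℕ.* suc d) d) (ℕ.≤-trans (ℕ.n≤1+n _) (ℕ.n≤1+n _)))))

    α-≥1 : ∀ {m} → d ℕ.≤ m → 1 ℕ.≤ α d m
    α-≥1 d≤m = subst (1 ℕ.≤_) (sym (ℕ.+-∸-comm 1 (ℕ.*-monoʳ-≤ d d≤m))) (ℕ.m≤n+m 1 _)

    α-suc-d : α d (suc d) ≡ suc d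
    α-suc-d = trans (cong (λ z → z ℕ.+ 1 ℕ.∸ d ℕ.* d) (ℕ.*-suc d d))
      (trans (cong (ℕ._∸ d ℕ.* d) (solve 2 (λ d a → d :+ a :+ con 1 := a :+ (d :+ con 1)) refl d (d ℕ.* d)))
      (trans (ℕ.m+n∸m≡n (d ℕ.* d) (d ℕ.+ 1)) (ℕ.+-comm d 1)))
      where open ℕ-Solver

    ratio≡α : ∀ j → d ℕ.≤ j → ratio d (suc j) ≡ ι (α d j) * 1/suc (α d (suc j) ℕ.+ d)
    ratio≡α j d≤j = trans (cong₂ (λ i n → i / suc n) numerator denominator) (/suc≡ι*1/suc (α d j) (α d (suc j) ℕ.+ d))
      where
      open ℕ-Solver
      dd = d ℕ.* d
      e  = d ℕ.* j ℕ.∸ dd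
      dj≡ : d ℕ.* j ≡ dd ℕ.+ e
      dj≡ = sym (ℕ.m+[n∸m]≡n (ℕ.*-monoʳ-≤ d d≤j))
      dk≡ : d ℕ.* suc j ≡ dd ℕ.+ (d ℕ.+ e)
      dk≡ = trans (ℕ.*-suc d j) (trans (cong (d ℕ.+_) dj≡) (solve 3 (λ d a e → d :+ (a :+ e) := a :+ (d :+ e)) refl d dd e))
      αj≡ : α d j ≡ e ℕ.+ 1
      αj≡ = trans (cong (λ z → z ℕ.+ 1 ℕ.∸ dd) dj≡) (trans (cong (ℕ._∸ dd) (ℕ.+-assoc dd e 1)) (ℕ.m+n∸m≡n dd (e ℕ.+ 1)))
      αk≡ : α d (suc j) ≡ d ℕ.+ e ℕ.+ 1
      αk≡ = trans (cong (λ z → z ℕ.+ 1 ℕ.∸ dd) dk≡) (trans (cong (ℕ._∸ dd) (ℕ.+-assoc dd (d ℕ.+ e) 1)) (ℕ.m+n∸m≡n dd (d ℕ.+ e ℕ.+ 1)))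
      +[m+n]-+m : ∀ a b → + (b ℕ.+ a) ℤ.- + b ≡ + a
      +[m+n]-+m a b = trans (ℤ.m-n≡m⊖n (b ℕ.+ a) b) (trans (ℤ.⊖-≥ (ℕ.m≤m+n b a)) (cong +_ (ℕ.m+n∸m≡n b a)))
      numerator : + (d ℕ.* suc j) ℤ.- + dd ℤ.- + d ℤ.+ + 1 ≡ + (α d j)
      numerator = begin
        + (d ℕ.* suc j) ℤ.- + dd ℤ.- + d ℤ.+ + 1       ≡⟨ cong (λ z → + z ℤ.- + dd ℤ.- + d ℤ.+ + 1) dk≡ ⟩
        + (dd ℕ.+ (d ℕ.+ e)) ℤ.- + dd ℤ.- + d ℤ.+ + 1  ≡⟨ cong (λ z → z ℤ.- + d ℤ.+ + 1) (+[m+n]-+m (d ℕ.+ e) dd) ⟩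
        + (d ℕ.+ e) ℤ.- + d ℤ.+ + 1                    ≡⟨ cong (ℤ._+ + 1) (+[m+n]-+m e d) ⟩
        + e ℤ.+ + 1                                     ≡⟨ cong +_ (sym αj≡) ⟩
        + (α d j)                                       ∎
        where open ≡-Reasoning
      denominator : d ℕ.* suc j ℕ.+ d ℕ.+ 1 ℕ.∸ dd ≡ α d (suc j) ℕ.+ d
      denominator = trans (cong (λ z → z ℕ.+ d ℕ.+ 1 ℕ.∸ dd) dk≡)
        (trans (cong (ℕ._∸ dd) (solve 3 (λ a d e → a :+ (d :+ e) :+ d :+ con 1 := a :+ (d :+ e :+ con 1 :+ d)) refl dd d e))
        (trans (ℕ.m+n∸m≡n dd (d ℕ.+ e ℕ.+ 1 ℕ.+ d)) (cong (ℕ._+ d) (sym αk≡))))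

    deviation-propagates : ∀ j P Q B′ → d ℕ.≤ j →
      P * (ι (α d (suc j)) + ι (suc d)) ≡ ι (α d j) * Q + ι (suc d) * ι (𝕀 (d ≡ᵇ j)) →
      (∀ t → ∣ EN d t j - Q * vertices t ∣ ≤ B′) →
      ∃ λ B → ∀ t → ∣ EN d t (suc j) - P * vertices t ∣ ≤ B
    deviation-propagates j P Q B′ d≤j fixed ∣y-Qn∣≤B′ =
      contraction-bounded z g (1/#cliques d) b K (α d (suc j)) 1≤b (1/#cliques-nonNeg d) b*i≤1 ∣g∣≤K z-step
      where
      a = ι (α d j)
      b = ι (α d (suc j))
      δ = ι (𝕀 (d ≡ᵇ j))
      E = ι (d ℕ.* suc (suc d))
      K = a * B′ + ∣ (P - δ) * E ∣
      z g : ℕ → ℚ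
      z t = EN d t (suc j) - P * vertices t
      g t = a * (EN d t j - Q * vertices t) + (P - δ) * E

      1≤b : 1ℚ ≤ b
      1≤b = ι-mono-≤ (α-≥1 (ℕ.m≤n⇒m≤1+n d≤j))

      b*i≤1 : ∀ t → α d (suc j) ℕ.≤ t → b * 1/#cliques d t ≤ 1ℚ
      b*i≤1 t T≤t = subst (b * 1/#cliques d t ≤_) (ι-#cliques*1/#cliques d t)
        (*-monoˡ-≤-≥0 (1/#cliques d t) (1/#cliques-nonNeg d t) (ι-≤-#cliques T≤t))

      ∣g∣≤K : ∀ t → ∣ g t ∣ ≤ K
      ∣g∣≤K t = begin
        ∣ g t ∣                                     ≤⟨ ∣p+q∣≤∣p∣+∣q∣ (a * (EN d t j - Q * vertices t)) ((P - δ) * E) ⟩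
        ∣ a * (EN d t j - Q * vertices t) ∣ + ∣ (P - δ) * E ∣
          ≡⟨ cong (_+ ∣ (P - δ) * E ∣) (trans (∣p*q∣≡∣p∣*∣q∣ a _) (cong (_* ∣ EN d t j - Q * vertices t ∣) (0≤p⇒∣p∣≡p (ι-nonNeg (α d j))))) ⟩
        a * ∣ EN d t j - Q * vertices t ∣ + ∣ (P - δ) * E ∣ ≤⟨ +-monoˡ-≤ ∣ (P - δ) * E ∣ (*-monoʳ-≤-≥0 a (ι-nonNeg (α d j)) (∣y-Qn∣≤B′ t)) ⟩
        K                                           ∎
        where open ≤-Reasoning

      z-step : ∀ t → z (suc t) ≡ z t * (1ℚ - b * 1/#cliques d t) + g t * 1/#cliques d t
      z-step t = deviation-step {x = EN d t (suc j)} {y = EN d t j} {a = a} {b} {δ} {P} {Q} {C = ι (#cliques d t)} {D = ι (suc d)} {E}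
        (EN-suc d t j) (vertices-suc t) (ι-#cliques*1/#cliques d t) (vertices≡#cliques t) fixed

    limit : ℕ → ℚ
    limit zero    = ½
    limit (suc m) = ratio d (suc m ℕ.+ suc d) * limit m

    deviation-bounded : ∀ m → ∃ λ B → ∀ t → ∣ EN d t (m ℕ.+ suc d) - limit m * vertices t ∣ ≤ B
    deviation-bounded zero = deviation-propagates d ½ 0ℚ 0ℚ ℕ.≤-refl fixed none
      where
      open ℚ-Solver
      D = ι (suc d)
      fixed : ½ * (ι (α d (suc d)) + D) ≡ ι (α d d) * 0ℚ + D * ι (𝕀 (d ≡ᵇ d))
      fixed = begin
        ½ * (ι (α d (suc d)) + D)           ≡⟨ cong (λ u → ½ * (ι u + D)) α-suc-d ⟩
        ½ * (D + D)                         ≡⟨ solve 2 (λ D a → con ½ :* (D :+ D) := a :* con 0ℚ :+ D :* con 1ℚ) refl D (ι (α d d)) ⟩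
        ι (α d d) * 0ℚ + D * 1ℚ             ≡⟨ cong (λ b → ι (α d d) * 0ℚ + D * ι (𝕀 b)) (sym (≡ᵇ-refl d)) ⟩
        ι (α d d) * 0ℚ + D * ι (𝕀 (d ≡ᵇ d)) ∎
        where open ≡-Reasoning
      none : ∀ t → ∣ EN d t d - 0ℚ * vertices t ∣ ≤ 0ℚ
      none t = ≤-reflexive (trans (cong (λ u → ∣ u - 0ℚ * vertices t ∣) (EN-below-min-degree d t))
                 (cong ∣_∣ (solve 1 (λ n → con 0ℚ :- con 0ℚ :* n := con 0ℚ) refl (vertices t))))
    deviation-bounded (suc m) = deviation-propagates j (limit (suc m)) (limit m) (proj₁ IH) d≤j fixed (proj₂ IH)
      where
      open ℚ-Solver
      IH = deviation-bounded m
      j = m ℕ.+ suc d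
      d≤j : d ℕ.≤ j
      d≤j = ℕ.≤-trans (ℕ.n≤1+n d) (ℕ.m≤n+m (suc d) m)
      a = ι (α d j)
      D = ι (suc d)
      n = α d (suc j) ℕ.+ d
      fixed : limit (suc m) * (ι (α d (suc j)) + D) ≡ a * limit m + D * ι (𝕀 (d ≡ᵇ j))
      fixed = begin
        ratio d (suc j) * limit m * (ι (α d (suc j)) + D)
          ≡⟨ cong₂ (λ u v → u * limit m * v) (ratio≡α j d≤j) (trans (sym (ι-+ (α d (suc j)) (suc d))) (cong ι (ℕ.+-suc (α d (suc j)) d))) ⟩
        a * 1/suc n * limit m * ι (suc n)
          ≡⟨ solve 4 (λ a i Q s → a :* i :* Q :* s := a :* Q :* (s :* i)) refl a (1/suc n) (limit m) (ι (suc n)) ⟩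
        a * limit m * (ι (suc n) * 1/suc n)
          ≡⟨ cong (a * limit m *_) (ι-suc*1/suc n) ⟩
        a * limit m * 1ℚ
          ≡⟨ solve 3 (λ a Q D → a :* Q :* con 1ℚ := a :* Q :+ D :* con 0ℚ) refl a (limit m) D ⟩
        a * limit m + D * 0ℚ
          ≡⟨ cong (λ b → a * limit m + D * ι (𝕀 b)) (sym (≢⇒≡ᵇ-false d j (ℕ.<⇒≢ (ℕ.m≤n+m (suc d) m)))) ⟩
        a * limit m + D * ι (𝕀 (d ≡ᵇ j)) ∎
        where open ≡-Reasoning


open import Defs
open import Data.Nat using (ℕ; suc; _≤_; _<_; _∸_; _+_; s≤s)
import Data.Nat.Properties as ℕ
open import Data.Product using (Σ; _×_; ∃; _,_; proj₁; proj₂)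
open import Data.Rational using (ℚ; ½; 0ℚ; ∣_∣; _-_; _*_) renaming (_<_ to _<ℚ_; _≤_ to _≤ℚ_)
open import Relation.Binary.PropositionalEquality using (_≡_; cong; subst; trans; module ≡-Reasoning)
open Limit
open Convergence

mainTheorem3 : (d : ℕ) → 1 ≤ d →
    Σ (ℕ → ℚ) λ P →
      ((k : ℕ) → suc d ≤ k → (ε : ℚ) → 0ℚ <ℚ ε →
        ∃ λ T → (t : ℕ) → T ≤ t → ∣ normalizedEN d t k - P k ∣ <ℚ ε)
      × P (suc d) ≡ ½
      × ((k : ℕ) → suc d < k → P k ≡ ratio d k * P (k ∸ 1))
mainTheorem3 d _ = P , converges , cong (limit d) (ℕ.n∸n≡0 (suc d)) , recurrence
  where
  P : ℕ → ℚ
  P k = limit d (k ∸ suc d)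

  converges : (k : ℕ) → suc d ≤ k → (ε : ℚ) → 0ℚ <ℚ ε → ∃ λ T → (t : ℕ) → T ≤ t → ∣ normalizedEN d t k - P k ∣ <ℚ ε
  converges k d<k = bounded-deviation⇒ratio-limit (λ t → EN d t k) (λ t → suc (d + t)) (P k) (proj₁ bounded)
    (λ t → ℕ.m≤n⇒m≤1+n (ℕ.m≤n+m t d))
    (λ t → subst (λ j → ∣ EN d t j - P k * vertices d t ∣ ≤ℚ proj₁ bounded) (ℕ.m∸n+n≡m d<k) (proj₂ bounded t))
    where bounded = deviation-bounded d (k ∸ suc d)

  recurrence : (k : ℕ) → suc d < k → P k ≡ ratio d k * P (k ∸ 1)
  recurrence (suc (suc k)) (s≤s (s≤s d≤k)) = begin
    limit d (suc k ∸ d)                       ≡⟨ cong (limit d) (ℕ.+-∸-assoc 1 d≤k) ⟩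
    ratio d (suc (k ∸ d + suc d)) * P (suc k) ≡⟨ cong (λ i → ratio d (suc i) * P (suc k)) (trans (ℕ.+-suc (k ∸ d) d) (cong suc (ℕ.m∸n+n≡m d≤k))) ⟩
    ratio d (suc (suc k)) * P (suc k)         ∎
    where open ≡-Reasoning
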